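{- For every positive integer $n$, the Domineering position $L_n^\cup$ has game value $2*$ if $n$ is even and $2$ if $n$ is odd, where, with cells indexed by integer pairs $(x,y)$ ($x$ the column, $y$ the row, $y$ increasing upward), $L_n^\cup$ is the set of empty cells $$\{(1,y): 0\le y\le 2n+2\}\cup\{(2,y): 1\le y\le 2n-1,\ y\text{ odd}\}\cup\{(0,2n+2),(2,2n+2),(0,2n+3),(2,2n+3)\}.$$
   Context: Domineering is played by two players, Left and Right, on a finite set of empty cells of the square grid $\mathbb{Z}^2$ (a "position"). A move by Left consists of choosing two vertically adjacent empty cells $(x,y),(x,y+1)$ and removing both (placing a vertical domino); a move by Right consists of choosing two horizontally adjacent empty cells $(x,y),(x+1,y)$ and removing both. Players alternate, and under normal play the first player unable to move loses. Positions are regarded as combinatorial games $G=\{G^L\mid G^R\}$ with the usual disjunctive sum and equality of combinatorial game theory; $0=\{\,\mid\,\}$, $*=\{0\mid 0\}$, $1=\{0\mid\,\}$, $2=\{1\mid\,\}$, and $2*=2+*$. (Geometrically, $L_n^\cup$ is a vertical chain of $n$ L-shapes in columns $1,2$, followed in column $1$ by two further cells $(1,2n),(1,2n+1)$, capped by a "hook": a full row of three cells at height $2n+2$ and the two outer cells at height $2n+3$.) -}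

module Defs where

open import Data.Nat using (ℕ; zero; suc; _+_; _*_)
open import Data.Integer using (ℤ; +_)
open import Data.Product using (_×_; _,_)
open import Data.Product.Properties using (≡-dec)
open import Data.Integer.Properties using () renaming (_≟_ to _≟ℤ_)
open import Data.List using (List; []; _∷_; _++_; map; length; upTo; filter; concatMap)
open import Data.List.Membership.DecPropositional using ()
open import Data.Bool using (Bool; true; false; if_then_else_)
open import Data.Unit using (⊤)
open import Relation.Nullary using (¬_; Dec; yes; no; does)
open import Relation.Binary.PropositionalEquality using (_≡_)

data Game : Set where
  ⟨_∣_⟩ : List Game → List Game → Game

mutual
  _≤G_ : Game → Game → Set
  ⟨ GL ∣ GR ⟩ ≤G H = NoneAbove GL H × NoneBelow H ⟨ GL ∣ GR ⟩

  NoneAbove : List Game → Game → Set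
  NoneAbove [] H = ⊤
  NoneAbove (x ∷ xs) H = ¬ (H ≤G x) × NoneAbove xs H

  NoneBelow : Game → Game → Set
  NoneBelow ⟨ HL ∣ HR ⟩ G = NoneBelowL HR G

  NoneBelowL : List Game → Game → Set
  NoneBelowL [] G = ⊤
  NoneBelowL (y ∷ ys) G = ¬ (y ≤G G) × NoneBelowL ys G

_≈G_ : Game → Game → Set
G ≈G H = (G ≤G H) × (H ≤G G)

mutual
  _+G_ : Game → Game → Game
  ⟨ GL ∣ GR ⟩ +G ⟨ HL ∣ HR ⟩ =
    ⟨ addL GL ⟨ HL ∣ HR ⟩ ++ addR ⟨ GL ∣ GR ⟩ HL
    ∣ addL GR ⟨ HL ∣ HR ⟩ ++ addR ⟨ GL ∣ GR ⟩ HR ⟩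

  addL : List Game → Game → List Game
  addL [] H = []
  addL (x ∷ xs) H = (x +G H) ∷ addL xs H

  addR : Game → List Game → List Game
  addR G [] = []
  addR G (y ∷ ys) = (G +G y) ∷ addR G ys

zeroG starG oneG twoG twoStarG : Game
zeroG = ⟨ [] ∣ [] ⟩
starG = ⟨ zeroG ∷ [] ∣ zeroG ∷ [] ⟩
oneG = ⟨ zeroG ∷ [] ∣ [] ⟩
twoG = ⟨ oneG ∷ [] ∣ [] ⟩
twoStarG = twoG +G starG

Cell : Set
Cell = ℤ × ℤ

_≟C_ : (c d : Cell) → Dec (c ≡ d)
_≟C_ = ≡-dec _≟ℤ_ _≟ℤ_

-- a position is a finite list of (distinct) empty cells
Position : Set
Position = List Cell

elem : Cell → Position → Bool
elem c [] = false
elem c (d ∷ ds) = if does (c ≟C d) then true else elem c ds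

remove : Cell → Position → Position
remove c P = filter (λ d → Relation.Nullary.¬? (d ≟C c)) P

up right : Cell → Cell
up (x , y) = (x , y Data.Integer.+ + 1)
right (x , y) = (x Data.Integer.+ + 1 , y)

leftMoves : Position → List Position
leftMoves P = concatMap (λ c → if elem (up c) P then remove (up c) (remove c P) ∷ [] else []) P

rightMoves : Position → List Position
rightMoves P = concatMap (λ c → if elem (right c) P then remove (right c) (remove c P) ∷ [] else []) P

-- game tree with depth bound k (fuel); every move removes two cells, so
-- fuel = number of cells is always sufficient for a duplicate-free list
domWith : ℕ → Position → Game
domWith zero P = ⟨ [] ∣ [] ⟩
domWith (suc k) P = ⟨ map (domWith k) (leftMoves P) ∣ map (domWith k) (rightMoves P) ⟩

domineering : Position → Game
domineering P = domWith (length P) P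

Lcup : ℕ → Position
Lcup n =
  map (λ y → (+ 1 , + y)) (upTo (2 * n + 3))
  ++ map (λ i → (+ 2 , + (2 * i + 1))) (upTo n)
  ++ ((+ 0 , + (2 * n + 2)) ∷ (+ 2 , + (2 * n + 2)) ∷ (+ 0 , + (2 * n + 3)) ∷ (+ 2 , + (2 * n + 3)) ∷ [])

module Submission where

-- Every piece of L_n^∪ is a "segment": a stretch of the central column with the teeth attached to
-- it, possibly reaching into the hook. Each move cuts a segment into pieces that no further domino
-- can join, so its options are sums of values of shorter segments. Guessing the values of all
-- segments (eventually periodic tables in the number of column cells) therefore reduces the
-- theorem, by induction on that number, to finitely many comparisons of short games, which are
-- decided by evaluation; L_n^∪ is the full segment with both hooks, and the table gives 2* or 2
-- according to the parity of n.

open import Data.Bool using (Bool; true; false; not; _∧_; _xor_; if_then_else_)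
open import Data.Bool.Properties using (T-≡; not-¬; not-injective; not-involutive; xor-identityʳ)
import Data.Bool.Properties as Bool
open import Data.Empty using (⊥; ⊥-elim)
open import Data.Integer using (ℤ; +_)
import Data.Integer.Properties as ℤ
open import Data.List using (List; []; _∷_; _++_; map; length; filter; filterᵇ; concatMap; upTo)
open import Data.List.Membership.Propositional using (_∈_; find)
open import Data.List.Membership.Propositional.Properties
open import Data.List.Properties using (filter-notAll; filter-accept; filter-reject; filter-all; map-cong-local)
open import Data.List.Relation.Unary.All using (All; all?; lookup; tabulate)
open import Data.List.Relation.Unary.All.Properties using (¬Any⇒All¬)
open import Data.List.Relation.Unary.Any using (Any; here; there; any?)
import Data.List.Relation.Unary.Any as Any
open import Data.Nat
open import Data.Nat.Divisibility using (_∣_; divides)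
open import Data.Nat.Induction using (<-rec)
open import Data.Nat.Properties
open import Data.Nat.Solver using (module +-*-Solver)
open +-*-Solver using (solve; _:=_; _:+_; _:*_; con)
open import Data.Product using (_×_; _,_; proj₁; proj₂; ∃; ∃₂)
open import Data.Sum using (_⊎_; inj₁; inj₂)
open import Data.Unit using (tt)
open import Function using (_∘_; id; Equivalence)
open import Relation.Binary.PropositionalEquality
open import Relation.Nullary
open import Relation.Nullary.Decidable using (True; toWitness; _×-dec_; _→-dec_; ¬?; T?)
import Relation.Unary as U

open import Defs

-- Conway's order on games

optL optR : Game → List Game
optL ⟨ l ∣ r ⟩ = l
optR ⟨ l ∣ r ⟩ = r

noneAbove⁻ : ∀ xs H → NoneAbove xs H → ∀ x → x ∈ xs → ¬ (H ≤G x)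
noneAbove⁻ (x ∷ xs) H (p , ps) .x (here refl) = p
noneAbove⁻ (x ∷ xs) H (p , ps) y (there m) = noneAbove⁻ xs H ps y m

noneAbove⁺ : ∀ xs H → (∀ x → x ∈ xs → ¬ (H ≤G x)) → NoneAbove xs H
noneAbove⁺ [] H f = tt
noneAbove⁺ (x ∷ xs) H f = f x (here refl) , noneAbove⁺ xs H (λ y m → f y (there m))

noneBelow⁻ : ∀ ys G → NoneBelowL ys G → ∀ y → y ∈ ys → ¬ (y ≤G G)
noneBelow⁻ (x ∷ xs) H (p , ps) .x (here refl) = p
noneBelow⁻ (x ∷ xs) H (p , ps) y (there m) = noneBelow⁻ xs H ps y m

noneBelow⁺ : ∀ ys G → (∀ y → y ∈ ys → ¬ (y ≤G G)) → NoneBelowL ys G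
noneBelow⁺ [] H f = tt
noneBelow⁺ (x ∷ xs) H f = f x (here refl) , noneBelow⁺ xs H (λ y m → f y (there m))

AllNotAbove AllNotBelow : Game → Game → Set
AllNotAbove G H = ∀ x → x ∈ optL G → ¬ (H ≤G x)
AllNotBelow G H = ∀ y → y ∈ optR H → ¬ (y ≤G G)

≤G⁻ : ∀ {G H} → G ≤G H → AllNotAbove G H × AllNotBelow G H
≤G⁻ {⟨ l ∣ r ⟩} {⟨ hl ∣ hr ⟩} (a , b) = noneAbove⁻ l _ a , noneBelow⁻ hr _ b

≤G⁺ : ∀ {G H} → AllNotAbove G H → AllNotBelow G H → G ≤G H
≤G⁺ {⟨ l ∣ r ⟩} {⟨ hl ∣ hr ⟩} a b = noneAbove⁺ l _ a , noneBelow⁺ hr _ b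

mutual
  _≤G?_ : ∀ G H → Dec (G ≤G H)
  ⟨ GL ∣ GR ⟩ ≤G? H = noneAbove? GL H ×-dec noneBelow? H ⟨ GL ∣ GR ⟩

  noneAbove? : ∀ xs H → Dec (NoneAbove xs H)
  noneAbove? [] H = yes tt
  noneAbove? (x ∷ xs) H = ¬? (H ≤G? x) ×-dec noneAbove? xs H

  noneBelow? : ∀ H G → Dec (NoneBelow H G)
  noneBelow? ⟨ HL ∣ HR ⟩ G = noneBelowL? HR G

  noneBelowL? : ∀ ys G → Dec (NoneBelowL ys G)
  noneBelowL? [] G = yes tt
  noneBelowL? (y ∷ ys) G = ¬? (y ≤G? G) ×-dec noneBelowL? ys G

mutual
  size : Game → ℕ
  size ⟨ l ∣ r ⟩ = suc (sizes l + sizes r)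

  sizes : List Game → ℕ
  sizes [] = 0
  sizes (x ∷ xs) = size x + sizes xs

∈-sizes : ∀ {x xs} → x ∈ xs → size x ≤ sizes xs
∈-sizes {x} {.x ∷ xs} (here refl) = m≤m+n (size x) (sizes xs)
∈-sizes {x} {y ∷ xs} (there m) = ≤-trans (∈-sizes m) (m≤n+m (sizes xs) (size y))

optL< : ∀ {x} G → x ∈ optL G → size x < size G
optL< ⟨ l ∣ r ⟩ m = s≤s (≤-trans (∈-sizes m) (m≤m+n (sizes l) (sizes r)))

optR< : ∀ {x} G → x ∈ optR G → size x < size G
optR< ⟨ l ∣ r ⟩ m = s≤s (≤-trans (∈-sizes m) (m≤n+m (sizes r) (sizes l)))

≤G-refl : ∀ G → G ≤G G
≤G-refl G = go (suc (size G)) G ≤-refl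
  where
  go : ∀ n G → size G < n → G ≤G G
  go (suc n) G (s≤s p) =
    ≤G⁺ (λ x m h → proj₁ (≤G⁻ h) x m (go n x (<-≤-trans (optL< G m) p)))
        (λ y m h → proj₂ (≤G⁻ h) y m (go n y (<-≤-trans (optR< G m) p)))

optL-≰ : ∀ {x} G → x ∈ optL G → ¬ (G ≤G x)
optL-≰ {x} G m h = proj₁ (≤G⁻ h) x m (≤G-refl x)

optR-≰ : ∀ {y} G → y ∈ optR G → ¬ (y ≤G G)
optR-≰ {y} G m h = proj₂ (≤G⁻ h) y m (≤G-refl y)

≤G-trans : ∀ {G H K} → G ≤G H → H ≤G K → G ≤G K
≤G-trans {G} {H} {K} = go (suc (size G + size H + size K)) G H K ≤-refl
  where
  rotateˡ : ∀ {x g} h k → x < g → h + k + x < g + h + k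
  rotateˡ {x} {g} h k p = <-≤-trans (+-monoʳ-< (h + k) p)
    (≤-reflexive (trans (+-comm (h + k) g) (sym (+-assoc g h k))))
  rotateʳ : ∀ {y k} g h → y < k → y + g + h < g + h + k
  rotateʳ {y} {k} g h p = ≤-<-trans (≤-reflexive (trans (+-assoc y g h) (+-comm y (g + h))))
    (+-monoʳ-< (g + h) p)
  go : ∀ n G H K → size G + size H + size K < n → G ≤G H → H ≤G K → G ≤G K
  go (suc n) G H K (s≤s p) gh hk =
    ≤G⁺ (λ x m kx → proj₁ (≤G⁻ gh) x m (go n H K x (≤-trans (rotateˡ (size H) (size K) (optL< G m)) p) hk kx))
        (λ y m yg → proj₂ (≤G⁻ hk) y m (go n y G H (≤-trans (rotateʳ (size G) (size H) (optR< K m)) p) yg gh))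

≈G-refl : ∀ G → G ≈G G
≈G-refl G = ≤G-refl G , ≤G-refl G

≈G-sym : ∀ {G H} → G ≈G H → H ≈G G
≈G-sym (a , b) = b , a

≈G-trans : ∀ {G H K} → G ≈G H → H ≈G K → G ≈G K
≈G-trans (a , b) (c , d) = ≤G-trans a c , ≤G-trans d b

¬≤G-optionˡ : ∀ {H x} → ¬ (H ≤G x) → (∃ λ (h : Game) → h ∈ optL H × x ≤G h) ⊎ (∃ λ (r : Game) → r ∈ optR x × r ≤G H)
¬≤G-optionˡ {H} {x} H≰x with any? (x ≤G?_) (optL H) | any? (_≤G? H) (optR x)
... | yes p | _ = inj₁ (find p)
... | no _ | yes q = inj₂ (find q)
... | no ¬p | no ¬q =
  ⊥-elim (H≰x (≤G⁺ (λ h m → lookup (¬Any⇒All¬ _ ¬p) m) (λ r m → lookup (¬Any⇒All¬ _ ¬q) m)))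

Matching : Game → Game → Set
Matching G H = (∀ x → x ∈ optL G → ∃ λ (y : Game) → y ∈ optL H × x ≈G y)
             × (∀ y → y ∈ optL H → ∃ λ (x : Game) → x ∈ optL G × x ≈G y)
             × (∀ x → x ∈ optR G → ∃ λ (y : Game) → y ∈ optR H × x ≈G y)
             × (∀ y → y ∈ optR H → ∃ λ (x : Game) → x ∈ optR G × x ≈G y)

≤G-byMatching : ∀ {G H} → (∀ x → x ∈ optL G → ∃ λ (y : Game) → y ∈ optL H × x ≈G y)
  → (∀ y → y ∈ optR H → ∃ λ (x : Game) → x ∈ optR G × x ≈G y) → G ≤G H
≤G-byMatching {G} {H} f g =
  ≤G⁺ (λ x m hx → let (y , my , xy) = f x m in optL-≰ H my (≤G-trans hx (proj₁ xy)))
      (λ y m yg → let (x , mx , xy) = g y m in optR-≰ G mx (≤G-trans (proj₁ xy) yg))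

≈G-byMatching : ∀ {G H} → Matching G H → G ≈G H
≈G-byMatching (a , b , c , d) =
  ≤G-byMatching a d ,
  ≤G-byMatching (λ y m → let (x , mx , e) = b y m in x , mx , ≈G-sym e)
                (λ x m → let (y , my , e) = c x m in y , my , ≈G-sym e)

≈G-byOptions : ∀ G v
  → (∀ x → x ∈ optL G → ¬ (v ≤G x))
  → (∀ y → y ∈ optR G → ¬ (y ≤G v))
  → (∀ u → u ∈ optL v → ∃ λ (x : Game) → x ∈ optL G × u ≤G x)
  → (∀ z → z ∈ optR v → ∃ λ (y : Game) → y ∈ optR G × y ≤G z)
  → G ≈G v
≈G-byOptions G v a b c d =
  ≤G⁺ a (λ z m zg → let (y , my , yz) = d z m in optR-≰ G my (≤G-trans yz zg)) ,
  ≤G⁺ (λ u m gu → let (x , mx , ux) = c u m in optL-≰ G mx (≤G-trans gu ux)) b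

noOptions≈0 : ∀ G → (∀ x → ¬ (x ∈ optL G)) → (∀ x → ¬ (x ∈ optR G)) → G ≈G zeroG
noOptions≈0 G a b = ≈G-byMatching ((λ x m → ⊥-elim (a x m)) , (λ y ()) , (λ x m → ⊥-elim (b x m)) , (λ y ()))

-- Disjunctive sums

addL⁺ : ∀ {x xs} H → x ∈ xs → (x +G H) ∈ addL xs H
addL⁺ {xs = x ∷ xs} H (here refl) = here refl
addL⁺ {xs = y ∷ xs} H (there m) = there (addL⁺ H m)

addR⁺ : ∀ {y ys} G → y ∈ ys → (G +G y) ∈ addR G ys
addR⁺ {ys = y ∷ ys} G (here refl) = here refl
addR⁺ {ys = x ∷ ys} G (there m) = there (addR⁺ G m)

addL⁻ : ∀ {z} xs H → z ∈ addL xs H → ∃ λ (x : Game) → x ∈ xs × z ≡ x +G H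
addL⁻ (x ∷ xs) H (here refl) = x , here refl , refl
addL⁻ (x ∷ xs) H (there m) = let (y , my , e) = addL⁻ xs H m in y , there my , e

addR⁻ : ∀ {z} G ys → z ∈ addR G ys → ∃ λ (y : Game) → y ∈ ys × z ≡ G +G y
addR⁻ G (y ∷ ys) (here refl) = y , here refl , refl
addR⁻ G (y ∷ ys) (there m) = let (x , mx , e) = addR⁻ G ys m in x , there mx , e

sumL₁ : ∀ {x} G K → x ∈ optL G → (x +G K) ∈ optL (G +G K)
sumL₁ ⟨ gl ∣ gr ⟩ ⟨ kl ∣ kr ⟩ m = ∈-++⁺ˡ (addL⁺ _ m)

sumL₂ : ∀ {y} G K → y ∈ optL K → (G +G y) ∈ optL (G +G K)
sumL₂ ⟨ gl ∣ gr ⟩ ⟨ kl ∣ kr ⟩ m = ∈-++⁺ʳ (addL gl _) (addR⁺ _ m)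

sumR₁ : ∀ {x} G K → x ∈ optR G → (x +G K) ∈ optR (G +G K)
sumR₁ ⟨ gl ∣ gr ⟩ ⟨ kl ∣ kr ⟩ m = ∈-++⁺ˡ (addL⁺ _ m)

sumR₂ : ∀ {y} G K → y ∈ optR K → (G +G y) ∈ optR (G +G K)
sumR₂ ⟨ gl ∣ gr ⟩ ⟨ kl ∣ kr ⟩ m = ∈-++⁺ʳ (addL gr _) (addR⁺ _ m)

SumOption : (Game → List Game) → Game → Game → Game → Set
SumOption o G K z = (∃ λ (x : Game) → x ∈ o G × z ≡ x +G K) ⊎ (∃ λ (y : Game) → y ∈ o K × z ≡ G +G y)

sumL⁻ : ∀ {z} G K → z ∈ optL (G +G K) → SumOption optL G K z
sumL⁻ ⟨ gl ∣ gr ⟩ ⟨ kl ∣ kr ⟩ m with ∈-++⁻ (addL gl _) m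
... | inj₁ p = inj₁ (addL⁻ gl _ p)
... | inj₂ p = inj₂ (addR⁻ _ kl p)

sumR⁻ : ∀ {z} G K → z ∈ optR (G +G K) → SumOption optR G K z
sumR⁻ ⟨ gl ∣ gr ⟩ ⟨ kl ∣ kr ⟩ m with ∈-++⁻ (addL gr _) m
... | inj₁ p = inj₁ (addL⁻ gr _ p)
... | inj₂ p = inj₂ (addR⁻ _ kr p)

data OneShrinks (a b c d a′ b′ c′ d′ : ℕ) : Set where
  shrink₁ : a′ < a → b′ ≤ b → c′ ≤ c → d′ ≤ d → OneShrinks a b c d a′ b′ c′ d′
  shrink₂ : a′ ≤ a → b′ < b → c′ ≤ c → d′ ≤ d → OneShrinks a b c d a′ b′ c′ d′
  shrink₃ : a′ ≤ a → b′ ≤ b → c′ < c → d′ ≤ d → OneShrinks a b c d a′ b′ c′ d′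
  shrink₄ : a′ ≤ a → b′ ≤ b → c′ ≤ c → d′ < d → OneShrinks a b c d a′ b′ c′ d′

oneShrinks⇒< : ∀ {a b c d a′ b′ c′ d′} → OneShrinks a b c d a′ b′ c′ d′ → a′ + b′ + c′ + d′ < a + b + c + d
oneShrinks⇒< (shrink₁ p q r s) = +-mono-<-≤ (+-mono-<-≤ (+-mono-<-≤ p q) r) s
oneShrinks⇒< (shrink₂ p q r s) = +-mono-<-≤ (+-mono-<-≤ (+-mono-≤-< p q) r) s
oneShrinks⇒< (shrink₃ p q r s) = +-mono-<-≤ (+-mono-≤-< (+-mono-≤ p q) r) s
oneShrinks⇒< (shrink₄ p q r s) = +-mono-≤-< (+-mono-≤ (+-mono-≤ p q) r) s

size₄ : Game → Game → Game → Game → ℕ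
size₄ G H K M = size G + size H + size K + size M

+G-mono : ∀ {G H K M} → G ≤G H → K ≤G M → (G +G K) ≤G (H +G M)
+G-mono {G} {H} {K} {M} = go (suc (size₄ G H K M)) G H K M ≤-refl
  where
  go : ∀ n G H K M → size₄ G H K M < n → G ≤G H → K ≤G M → (G +G K) ≤G (H +G M)
  go (suc n) G H K M (s≤s b) gh km = ≤G⁺ leftPart rightPart
    where
    rec : ∀ G′ H′ K′ M′ → OneShrinks (size G) (size H) (size K) (size M) (size G′) (size H′) (size K′) (size M′)
        → G′ ≤G H′ → K′ ≤G M′ → (G′ +G K′) ≤G (H′ +G M′)
    rec G′ H′ K′ M′ d = go n G′ H′ K′ M′ (≤-trans (oneShrinks⇒< d) b)
    leftPart : AllNotAbove (G +G K) (H +G M)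
    leftPart z mz hz with sumL⁻ G K mz
    leftPart z mz hz | inj₁ (x , mx , refl) with ¬≤G-optionˡ (proj₁ (≤G⁻ gh) x mx)
    ... | inj₁ (h , mh , xh) = optL-≰ (H +G M) (sumL₁ H M mh)
           (≤G-trans hz (rec x h K M (shrink₁ (optL< G mx) (<⇒≤ (optL< H mh)) ≤-refl ≤-refl) xh km))
    ... | inj₂ (r , mr , rH) = optR-≰ (x +G K) (sumR₁ x K mr)
           (≤G-trans (rec r H K M (shrink₁ (<-trans (optR< x mr) (optL< G mx)) ≤-refl ≤-refl ≤-refl) rH km) hz)
    leftPart z mz hz | inj₂ (y , my , refl) with ¬≤G-optionˡ (proj₁ (≤G⁻ km) y my)
    ... | inj₁ (m′ , mm , ym) = optL-≰ (H +G M) (sumL₂ H M mm)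
           (≤G-trans hz (rec G H y m′ (shrink₃ ≤-refl ≤-refl (optL< K my) (<⇒≤ (optL< M mm))) gh ym))
    ... | inj₂ (r , mr , rM) = optR-≰ (G +G y) (sumR₂ G y mr)
           (≤G-trans (rec G H r M (shrink₃ ≤-refl ≤-refl (<-trans (optR< y mr) (optL< K my)) ≤-refl) gh rM) hz)
    rightPart : AllNotBelow (G +G K) (H +G M)
    rightPart w mw hw with sumR⁻ H M mw
    rightPart w mw hw | inj₁ (z , mz , refl) with ¬≤G-optionˡ (proj₂ (≤G⁻ gh) z mz)
    ... | inj₁ (l , ml , Gl) = optL-≰ (z +G M) (sumL₁ z M ml)
           (≤G-trans hw (rec G l K M (shrink₂ ≤-refl (<-trans (optL< z ml) (optR< H mz)) ≤-refl ≤-refl) Gl km))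
    ... | inj₂ (g , mg , gz) = optR-≰ (G +G K) (sumR₁ G K mg)
           (≤G-trans (rec g z K M (shrink₁ (optR< G mg) (<⇒≤ (optR< H mz)) ≤-refl ≤-refl) gz km) hw)
    rightPart w mw hw | inj₂ (w′ , mw′ , refl) with ¬≤G-optionˡ (proj₂ (≤G⁻ km) w′ mw′)
    ... | inj₁ (l , ml , Kl) = optL-≰ (H +G w′) (sumL₂ H w′ ml)
           (≤G-trans hw (rec G H K l (shrink₄ ≤-refl ≤-refl ≤-refl (<-trans (optL< w′ ml) (optR< M mw′))) gh Kl))
    ... | inj₂ (k , mk , kw) = optR-≰ (G +G K) (sumR₂ G K mk)
           (≤G-trans (rec G H k w′ (shrink₃ ≤-refl ≤-refl (optR< K mk) (<⇒≤ (optR< M mw′))) gh kw) hw)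

+G-cong : ∀ {G H K M} → G ≈G H → K ≈G M → (G +G K) ≈G (H +G M)
+G-cong (a , b) (c , d) = +G-mono a c , +G-mono b d

+G-identityˡ : ∀ G → (zeroG +G G) ≈G G
+G-identityˡ G = go (suc (size G)) G ≤-refl
  where
  go : ∀ n G → size G < n → (zeroG +G G) ≈G G
  go (suc n) G (s≤s b) = ≈G-byMatching (f1 , f2 , f3 , f4)
    where
    f1 : ∀ x → x ∈ optL (zeroG +G G) → ∃ λ y → y ∈ optL G × x ≈G y
    f1 z m with sumL⁻ zeroG G m
    ... | inj₂ (y , my , refl) = y , my , go n y (≤-trans (optL< G my) b)
    f2 : ∀ y → y ∈ optL G → ∃ λ x → x ∈ optL (zeroG +G G) × x ≈G y
    f2 y m = (zeroG +G y) , sumL₂ zeroG G m , go n y (≤-trans (optL< G m) b)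
    f3 : ∀ x → x ∈ optR (zeroG +G G) → ∃ λ y → y ∈ optR G × x ≈G y
    f3 z m with sumR⁻ zeroG G m
    ... | inj₂ (y , my , refl) = y , my , go n y (≤-trans (optR< G my) b)
    f4 : ∀ y → y ∈ optR G → ∃ λ x → x ∈ optR (zeroG +G G) × x ≈G y
    f4 y m = (zeroG +G y) , sumR₂ zeroG G m , go n y (≤-trans (optR< G m) b)

-- Domineering positions and their options

elem→∈ : ∀ c P → elem c P ≡ true → c ∈ P
elem→∈ c [] ()
elem→∈ c (d ∷ ds) e with c ≟C d
... | yes refl = here refl
... | no _ = there (elem→∈ c ds e)

∈→elem : ∀ {c P} → c ∈ P → elem c P ≡ true
∈→elem {c} {d ∷ ds} (here refl) with c ≟C c
... | yes _ = refl
... | no c≢c = ⊥-elim (c≢c refl)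
∈→elem {c} {d ∷ ds} (there m) with c ≟C d
... | yes _ = refl
... | no _ = ∈→elem m

remove⁻ : ∀ {c d P} → c ∈ remove d P → c ∈ P × c ≢ d
remove⁻ {d = d} = ∈-filter⁻ (λ x → ¬? (x ≟C d))

remove⁺ : ∀ {c d P} → c ∈ P → c ≢ d → c ∈ remove d P
remove⁺ {d = d} = ∈-filter⁺ (λ x → ¬? (x ≟C d))

length-remove : ∀ {c P} → c ∈ P → length (remove c P) < length P
length-remove {c} {P} m = filter-notAll (λ x → ¬? (x ≟C c)) P (Any.map (λ c≡x x≢c → x≢c (sym c≡x)) m)

rm2 : (Cell → Cell) → Cell → Position → Position
rm2 mv c P = remove (mv c) (remove c P)

moves : (Cell → Cell) → Position → List Position
moves mv P = concatMap (λ c → if elem (mv c) P then rm2 mv c P ∷ [] else []) P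

IsMove : (Cell → Cell) → Position → Position → Set
IsMove mv P Q = ∃ λ (c : Cell) → c ∈ P × mv c ∈ P × Q ≡ rm2 mv c P

moves⁻ : ∀ mv P {Q} → Q ∈ moves mv P → IsMove mv P Q
moves⁻ mv P {Q} m = go P (∈-concatMap⁻ _ {xs = P} m)
  where
  go : ∀ xs → Any (λ c → Q ∈ (if elem (mv c) P then rm2 mv c P ∷ [] else [])) xs
     → ∃ λ (c : Cell) → c ∈ xs × mv c ∈ P × Q ≡ rm2 mv c P
  go (c ∷ xs) (here p) with elem (mv c) P in eq
  go (c ∷ xs) (here (here refl)) | true = c , here refl , elem→∈ _ P eq , refl
  go (c ∷ xs) (there a) = let (d , md , m2 , e) = go xs a in d , there md , m2 , e

moves⁺ : ∀ mv P c → c ∈ P → mv c ∈ P → rm2 mv c P ∈ moves mv P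
moves⁺ mv P c m1 m2 = ∈-concatMap⁺ _ {xs = P} (go P m1)
  where
  ∈-if : ∀ {b} {Q : Position} → b ≡ true → Q ∈ (if b then Q ∷ [] else [])
  ∈-if refl = here refl
  go : ∀ xs → c ∈ xs → Any (λ d → rm2 mv c P ∈ (if elem (mv d) P then rm2 mv d P ∷ [] else [])) xs
  go (d ∷ xs) (here refl) = here (∈-if (∈→elem m2))
  go (d ∷ xs) (there m) = there (go xs m)

up≢ : ∀ c → up c ≢ c
up≢ (x , y) e = ℤ.i≢suc[i] {y} (sym (trans (ℤ.+-comm (+ 1) y) (cong proj₂ e)))

right≢ : ∀ c → right c ≢ c
right≢ (x , y) e = ℤ.i≢suc[i] {x} (sym (trans (ℤ.+-comm (+ 1) x) (cong proj₁ e)))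

length-move : ∀ mv → (∀ c → mv c ≢ c) → ∀ {P Q} → Q ∈ moves mv P → 2 + length Q ≤ length P
length-move mv ne {P} m with moves⁻ mv P m
... | c , m1 , m2 , refl = ≤-trans (s≤s (length-remove (remove⁺ m2 (ne c)))) (length-remove m1)

-- Every move removes two cells, so any fuel of at least the number of cells gives the same game tree.
domWith-fuel : ∀ k k′ P → length P ≤ k → length P ≤ k′ → domWith k P ≡ domWith k′ P
domWith-fuel zero zero [] _ _ = refl
domWith-fuel zero (suc k′) [] _ _ = refl
domWith-fuel (suc k) zero [] _ _ = refl
domWith-fuel (suc k) (suc k′) P p q = cong₂ ⟨_∣_⟩ (options up up≢) (options right right≢)
  where
  options : ∀ mv → (∀ c → mv c ≢ c) → map (domWith k) (moves mv P) ≡ map (domWith k′) (moves mv P)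
  options mv ne = map-cong-local (tabulate λ m →
    let l = ≤-trans (n≤1+n _) (length-move mv ne {P} m) in
    domWith-fuel k k′ _ (≤-pred (≤-trans l p)) (≤-pred (≤-trans l q)))

domineering-unfold : ∀ P → domineering P ≡ ⟨ map domineering (leftMoves P) ∣ map domineering (rightMoves P) ⟩
domineering-unfold P = trans (domWith-fuel (length P) (suc (length P)) P ≤-refl (n≤1+n _))
                             (cong₂ ⟨_∣_⟩ (options up up≢) (options right right≢))
  where
  options : ∀ mv → (∀ c → mv c ≢ c) → map (domWith (length P)) (moves mv P) ≡ map domineering (moves mv P)
  options mv ne = map-cong-local (tabulate λ m →
    domWith-fuel (length P) _ _ (≤-trans (n≤1+n _) (≤-trans (n≤1+n _) (length-move mv ne {P} m))) ≤-refl)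

optL-dom⁻ : ∀ P {x} → x ∈ optL (domineering P) → ∃ λ (Q : Position) → IsMove up P Q × x ≡ domineering Q
optL-dom⁻ P m rewrite domineering-unfold P = let (Q , mQ , e) = ∈-map⁻ domineering m in Q , moves⁻ up P mQ , e

optR-dom⁻ : ∀ P {x} → x ∈ optR (domineering P) → ∃ λ (Q : Position) → IsMove right P Q × x ≡ domineering Q
optR-dom⁻ P m rewrite domineering-unfold P = let (Q , mQ , e) = ∈-map⁻ domineering m in Q , moves⁻ right P mQ , e

optL-dom⁺ : ∀ P c → c ∈ P → up c ∈ P → domineering (rm2 up c P) ∈ optL (domineering P)
optL-dom⁺ P c m1 m2 rewrite domineering-unfold P = ∈-map⁺ domineering (moves⁺ up P c m1 m2)

optR-dom⁺ : ∀ P c → c ∈ P → right c ∈ P → domineering (rm2 right c P) ∈ optR (domineering P)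
optR-dom⁺ P c m1 m2 rewrite domineering-unfold P = ∈-map⁺ domineering (moves⁺ right P c m1 m2)

-- A position cut by a Boolean colouring that no domino crosses is a sum

filter-comm : ∀ {a p q} {A : Set a} {P : A → Set p} {Q : A → Set q} (P? : U.Decidable P) (Q? : U.Decidable Q)
  → ∀ xs → filter P? (filter Q? xs) ≡ filter Q? (filter P? xs)
filter-comm P? Q? [] = refl
filter-comm P? Q? (x ∷ xs) with P? x | Q? x
... | yes px | yes qx
  rewrite filter-accept P? {xs = filter Q? xs} px | filter-accept Q? {xs = filter P? xs} qx
  = cong (x ∷_) (filter-comm P? Q? xs)
... | yes px | no ¬qx rewrite filter-reject Q? {xs = filter P? xs} ¬qx = filter-comm P? Q? xs
... | no ¬px | yes qx rewrite filter-reject P? {xs = filter Q? xs} ¬px = filter-comm P? Q? xs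
... | no ¬px | no ¬qx = filter-comm P? Q? xs

∈-filterᵇ⁻ : ∀ (ρ : Cell → Bool) {c} P → c ∈ filterᵇ ρ P → c ∈ P × ρ c ≡ true
∈-filterᵇ⁻ ρ P m = let (m′ , t) = ∈-filter⁻ (T? ∘ ρ) m in m′ , Equivalence.to T-≡ t

∈-filterᵇ⁺ : ∀ (ρ : Cell → Bool) {c} P → c ∈ P → ρ c ≡ true → c ∈ filterᵇ ρ P
∈-filterᵇ⁺ ρ P m e = ∈-filter⁺ (T? ∘ ρ) m (Equivalence.from T-≡ e)

filterᵇ-remove : ∀ ρ d P → filterᵇ ρ (remove d P) ≡ remove d (filterᵇ ρ P)
filterᵇ-remove ρ d = filter-comm (T? ∘ ρ) (λ x → ¬? (x ≟C d))

filterᵇ-remove-rejected : ∀ ρ d P → ρ d ≡ false → filterᵇ ρ (remove d P) ≡ filterᵇ ρ P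
filterᵇ-remove-rejected ρ d P e = trans (filterᵇ-remove ρ d P) (filter-all (λ x → ¬? (x ≟C d)) (tabulate λ m c≡d →
  not-¬ (proj₂ (∈-filterᵇ⁻ ρ P m)) (trans (cong ρ c≡d) e)))

filterᵇ-rm2 : ∀ (ρ : Cell → Bool) mv c P → filterᵇ ρ (rm2 mv c P) ≡ rm2 mv c (filterᵇ ρ P)
filterᵇ-rm2 ρ mv c P = trans (filterᵇ-remove ρ (mv c) (remove c P)) (cong (remove (mv c)) (filterᵇ-remove ρ c P))

filterᵇ-rm2-rejected : ∀ (ρ : Cell → Bool) mv c P → ρ c ≡ false → ρ (mv c) ≡ false → filterᵇ ρ (rm2 mv c P) ≡ filterᵇ ρ P
filterᵇ-rm2-rejected ρ mv c P e₁ e₂ =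
  trans (filterᵇ-remove-rejected ρ (mv c) (remove c P) e₂) (filterᵇ-remove-rejected ρ c P e₁)

Respects : (Cell → Cell) → (Cell → Bool) → Position → Set
Respects mv ρ P = ∀ {c} → c ∈ P → mv c ∈ P → ρ (mv c) ≡ ρ c

Separates : (Cell → Bool) → Position → Set
Separates ρ P = Respects up ρ P × Respects right ρ P

rm2⊆ : ∀ mv c P {d} → d ∈ rm2 mv c P → d ∈ P
rm2⊆ mv c P m = proj₁ (remove⁻ (proj₁ (remove⁻ m)))

separates-rm2 : ∀ {ρ} mv c P → Separates ρ P → Separates ρ (rm2 mv c P)
separates-rm2 mv c P (su , sr) =
  (λ m m′ → su (rm2⊆ mv c P m) (rm2⊆ mv c P m′)) , (λ m m′ → sr (rm2⊆ mv c P m) (rm2⊆ mv c P m′))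

domineering-cong : ∀ {P Q} → P ≡ Q → domineering P ≈G domineering Q
domineering-cong refl = ≈G-refl _

record Side : Set where
  field
    mv : Cell → Cell
    mv≢ : ∀ c → mv c ≢ c
    opt : Game → List Game
    respects : ∀ {ρ P} → Separates ρ P → Respects mv ρ P
    dom⁻ : ∀ P {x} → x ∈ opt (domineering P) → ∃ λ (Q : Position) → IsMove mv P Q × x ≡ domineering Q
    dom⁺ : ∀ P c → c ∈ P → mv c ∈ P → domineering (rm2 mv c P) ∈ opt (domineering P)
    sum₁ : ∀ {x} G K → x ∈ opt G → (x +G K) ∈ opt (G +G K)
    sum₂ : ∀ {y} G K → y ∈ opt K → (G +G y) ∈ opt (G +G K)
    sum⁻ : ∀ {z} G K → z ∈ opt (G +G K) → SumOption opt G K z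

leftSide rightSide : Side
leftSide = record { mv = up ; mv≢ = up≢ ; opt = optL ; respects = proj₁
  ; dom⁻ = optL-dom⁻ ; dom⁺ = optL-dom⁺ ; sum₁ = sumL₁ ; sum₂ = sumL₂ ; sum⁻ = sumL⁻ }
rightSide = record { mv = right ; mv≢ = right≢ ; opt = optR ; respects = proj₂
  ; dom⁻ = optR-dom⁻ ; dom⁺ = optR-dom⁺ ; sum₁ = sumR₁ ; sum₂ = sumR₂ ; sum⁻ = sumR⁻ }

module Split (ρ : Cell → Bool) where

  SplitsAs : Position → Set
  SplitsAs P = domineering P ≈G (domineering (filterᵇ ρ P) +G domineering (filterᵇ (not ∘ ρ) P))

  -- A domino lies on one side of the cut, so the move touches only that summand.
  move-split : ∀ mv P c → ρ (mv c) ≡ ρ c → SplitsAs (rm2 mv c P)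
    → (ρ c ≡ true × domineering (rm2 mv c P) ≈G (domineering (rm2 mv c (filterᵇ ρ P)) +G domineering (filterᵇ (not ∘ ρ) P)))
    ⊎ (ρ c ≡ false × domineering (rm2 mv c P) ≈G (domineering (filterᵇ ρ P) +G domineering (rm2 mv c (filterᵇ (not ∘ ρ) P))))
  move-split mv P c e split with ρ c in eq
  ... | true = inj₁ (refl , ≈G-trans split (+G-cong
          (domineering-cong (filterᵇ-rm2 ρ mv c P))
          (domineering-cong (filterᵇ-rm2-rejected (not ∘ ρ) mv c P (cong not eq) (cong not e)))))
  ... | false = inj₂ (refl , ≈G-trans split (+G-cong
          (domineering-cong (filterᵇ-rm2-rejected ρ mv c P eq e))
          (domineering-cong (filterᵇ-rm2 (not ∘ ρ) mv c P))))

  module Options (s : Side) (P : Position) (sep : Separates ρ P)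
    (ih : ∀ c → c ∈ P → Side.mv s c ∈ P → SplitsAs (rm2 (Side.mv s) c P)) where
    open Side s

    A B : Position
    A = filterᵇ ρ P
    B = filterᵇ (not ∘ ρ) P

    forth : ∀ x → x ∈ opt (domineering P) → ∃ λ (y : Game) → y ∈ opt (domineering A +G domineering B) × x ≈G y
    forth x m with dom⁻ P m
    ... | Q , (c , m₁ , m₂ , refl) , refl with move-split mv P c (respects sep m₁ m₂) (ih c m₁ m₂)
    ... | inj₁ (e , h) = _ , sum₁ _ _ (dom⁺ A c (∈-filterᵇ⁺ ρ P m₁ e) (∈-filterᵇ⁺ ρ P m₂ (trans (respects sep m₁ m₂) e))) , h
    ... | inj₂ (e , h) = _ , sum₂ _ _ (dom⁺ B c (∈-filterᵇ⁺ (not ∘ ρ) P m₁ (cong not e))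
                                                 (∈-filterᵇ⁺ (not ∘ ρ) P m₂ (cong not (trans (respects sep m₁ m₂) e)))) , h

    fromA : ∀ {x} → x ∈ opt (domineering A) → ∃ λ (x′ : Game) → x′ ∈ opt (domineering P) × x′ ≈G (x +G domineering B)
    fromA mx with dom⁻ A mx
    ... | _ , (c , m₁ , m₂ , refl) , refl = pick (∈-filterᵇ⁻ ρ P m₁) (∈-filterᵇ⁻ ρ P m₂)
      where
      pick : c ∈ P × ρ c ≡ true → mv c ∈ P × ρ (mv c) ≡ true
        → ∃ λ (x′ : Game) → x′ ∈ opt (domineering P) × x′ ≈G (domineering (rm2 mv c A) +G domineering B)
      pick (p₁ , e₁) (p₂ , _) with move-split mv P c (respects sep p₁ p₂) (ih c p₁ p₂)
      ... | inj₁ (_ , h) = _ , dom⁺ P c p₁ p₂ , h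
      ... | inj₂ (e , _) = ⊥-elim (not-¬ e e₁)

    fromB : ∀ {x} → x ∈ opt (domineering B) → ∃ λ (x′ : Game) → x′ ∈ opt (domineering P) × x′ ≈G (domineering A +G x)
    fromB mx with dom⁻ B mx
    ... | _ , (c , m₁ , m₂ , refl) , refl = pick (∈-filterᵇ⁻ (not ∘ ρ) P m₁) (∈-filterᵇ⁻ (not ∘ ρ) P m₂)
      where
      pick : c ∈ P × not (ρ c) ≡ true → mv c ∈ P × not (ρ (mv c)) ≡ true
        → ∃ λ (x′ : Game) → x′ ∈ opt (domineering P) × x′ ≈G (domineering A +G domineering (rm2 mv c B))
      pick (p₁ , e₁) (p₂ , _) with move-split mv P c (respects sep p₁ p₂) (ih c p₁ p₂)
      ... | inj₂ (_ , h) = _ , dom⁺ P c p₁ p₂ , h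
      ... | inj₁ (e , _) = ⊥-elim (not-¬ (cong not e) e₁)

    back : ∀ y → y ∈ opt (domineering A +G domineering B) → ∃ λ (x : Game) → x ∈ opt (domineering P) × x ≈G y
    back y m with sum⁻ (domineering A) (domineering B) m
    ... | inj₁ (x , mx , refl) = fromA mx
    ... | inj₂ (x , mx , refl) = fromB mx

  domineering-split : ∀ P → Separates ρ P → SplitsAs P
  domineering-split P = go (suc (length P)) P ≤-refl
    where
    go : ∀ n P → length P < n → Separates ρ P → SplitsAs P
    go (suc n) P (s≤s lP) sep = ≈G-byMatching (L.forth , L.back , R.forth , R.back)
      where
      ih : ∀ s → ∀ c → c ∈ P → Side.mv s c ∈ P → SplitsAs (rm2 (Side.mv s) c P)
      ih s c m₁ m₂ = go n _ (≤-trans (≤-trans (n≤1+n _) (length-move (Side.mv s) (Side.mv≢ s) {P} (moves⁺ (Side.mv s) P c m₁ m₂))) lP)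
                       (separates-rm2 (Side.mv s) c P sep)
      module L = Options leftSide P sep (ih leftSide)
      module R = Options rightSide P sep (ih rightSide)

-- Positions described by shapes in the first quadrant

cell : ℕ → ℕ → Cell
cell x y = (+ x , + y)

cell-injective : ∀ {x y x′ y′} → cell x y ≡ cell x′ y′ → x ≡ x′ × y ≡ y′
cell-injective refl = refl , refl

up-cell : ∀ x y → up (cell x y) ≡ cell x (suc y)
up-cell x y = cong (cell x) (+-comm y 1)

right-cell : ∀ x y → right (cell x y) ≡ cell (suc x) y
right-cell x y = cong (λ z → cell z y) (+-comm x 1)

Shape : Set₁
Shape = ℕ → ℕ → Set

Realises : Shape → Position → Set
Realises S P = (∀ c → c ∈ P → ∃₂ λ x y → c ≡ cell x y × S x y) × (∀ x y → S x y → cell x y ∈ P)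

-- Colourings are given on ℕ²; cells with a negative coordinate never occur in a realised shape.
onCells : (ℕ → ℕ → Bool) → Cell → Bool
onCells ρ (+ x , + y) = ρ x y
onCells ρ _ = false

realises-⇔ : ∀ {S S′ P} → (∀ x y → S x y → S′ x y) → (∀ x y → S′ x y → S x y) → Realises S P → Realises S′ P
realises-⇔ f g (a , b) = (λ c m → let (x , y , e , s) = a c m in x , y , e , f x y s) , (λ x y s → b x y (g x y s))

realises-filter : ∀ {S P} ρ → Realises S P → Realises (λ x y → S x y × ρ x y ≡ true) (filterᵇ (onCells ρ) P)
realises-filter {S} {P} ρ (a , f) = to , λ x y (s , e) → ∈-filterᵇ⁺ _ P (f x y s) e
  where
  to : ∀ c → c ∈ filterᵇ (onCells ρ) P → ∃₂ λ x y → c ≡ cell x y × S x y × ρ x y ≡ true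
  to c m with ∈-filterᵇ⁻ _ P m
  ... | m′ , e with a c m′
  ... | x , y , refl , s = x , y , refl , s , e

realises-filter-not : ∀ {S P} ρ → Realises S P → Realises (λ x y → S x y × ρ x y ≡ false) (filterᵇ (not ∘ onCells ρ) P)
realises-filter-not {S} {P} ρ (a , f) = to , λ x y (s , e) → ∈-filterᵇ⁺ _ P (f x y s) (cong not e)
  where
  to : ∀ c → c ∈ filterᵇ (not ∘ onCells ρ) P → ∃₂ λ x y → c ≡ cell x y × S x y × ρ x y ≡ false
  to c m with ∈-filterᵇ⁻ _ P m
  ... | m′ , e with a c m′
  ... | x , y , refl , s = x , y , refl , s , not-injective {y = false} e

Avoids : ℕ → ℕ → ℕ → ℕ → ℕ → ℕ → Set
Avoids x y x₁ y₁ x₂ y₂ = ¬ (x ≡ x₁ × y ≡ y₁) × ¬ (x ≡ x₂ × y ≡ y₂)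

realises-rm2 : ∀ {S P} mv x₀ y₀ x₁ y₁ → mv (cell x₀ y₀) ≡ cell x₁ y₁ → Realises S P
  → Realises (λ x y → S x y × Avoids x y x₀ y₀ x₁ y₁) (rm2 mv (cell x₀ y₀) P)
realises-rm2 {S} {P} mv x₀ y₀ x₁ y₁ e (a , f) = to , from
  where
  to : ∀ c → c ∈ rm2 mv (cell x₀ y₀) P → ∃₂ λ x y → c ≡ cell x y × S x y × Avoids x y x₀ y₀ x₁ y₁
  to c m with remove⁻ m
  ... | m₁ , n₁ with remove⁻ m₁
  ... | m₂ , n₂ with a c m₂
  ... | x , y , refl , s = x , y , refl , s , (λ (p , q) → n₂ (cong₂ cell p q)) , (λ (p , q) → n₁ (trans (cong₂ cell p q) (sym e)))
  from : ∀ x y → S x y × Avoids x y x₀ y₀ x₁ y₁ → cell x y ∈ rm2 mv (cell x₀ y₀) P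
  from x y (s , n , n′) = remove⁺ (remove⁺ (f x y s) (n ∘ cell-injective)) (λ c → n′ (cell-injective (trans c e)))

realises-up : ∀ {S P} → Realises S P → ∀ {c} → c ∈ P → up c ∈ P → ∃₂ λ x y → c ≡ cell x y × S x y × S x (suc y)
realises-up (a , _) {c} m₁ m₂ with a c m₁
... | x , y , refl , s with a _ m₂
... | x′ , y′ , e , s′ with cell-injective (trans (sym (up-cell x y)) e)
... | refl , refl = x , y , refl , s , s′

realises-right : ∀ {S P} → Realises S P → ∀ {c} → c ∈ P → right c ∈ P → ∃₂ λ x y → c ≡ cell x y × S x y × S (suc x) y
realises-right (a , _) {c} m₁ m₂ with a c m₁
... | x , y , refl , s with a _ m₂
... | x′ , y′ , e , s′ with cell-injective (trans (sym (right-cell x y)) e)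
... | refl , refl = x , y , refl , s , s′

separates-byShape : ∀ {S P} ρ → Realises S P
  → (∀ x y → S x y → S x (suc y) → ρ x (suc y) ≡ ρ x y)
  → (∀ x y → S x y → S (suc x) y → ρ (suc x) y ≡ ρ x y)
  → Separates (onCells ρ) P
separates-byShape ρ sp fv fh = vertical , horizontal
  where
  vertical : Respects up (onCells ρ) _
  vertical m₁ m₂ with realises-up sp m₁ m₂
  ... | x , y , refl , s₁ , s₂ = trans (cong (onCells ρ) (up-cell x y)) (fv x y s₁ s₂)
  horizontal : Respects right (onCells ρ) _
  horizontal m₁ m₂ with realises-right sp m₁ m₂
  ... | x , y , refl , s₁ , s₂ = trans (cong (onCells ρ) (right-cell x y)) (fh x y s₁ s₂)

realises-noMoves : ∀ {S P} → Realises S P → (∀ x y → S x y → ¬ S x (suc y)) → (∀ x y → S x y → ¬ S (suc x) y)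
  → domineering P ≈G zeroG
realises-noMoves {P = P} sp fv fh = noOptions≈0 (domineering P)
  (λ _ m → let (_ , (_ , m₁ , m₂ , _) , _) = optL-dom⁻ P m ; (x , y , _ , s₁ , s₂) = realises-up sp m₁ m₂ in fv x y s₁ s₂)
  (λ _ m → let (_ , (_ , m₁ , m₂ , _) , _) = optR-dom⁻ P m ; (x , y , _ , s₁ , s₂) = realises-right sp m₁ m₂ in fh x y s₁ s₂)

-- Eventually periodic families of decidable facts

swap-+ : ∀ m j k → m + (j + k) ≡ j + (m + k)
swap-+ m j k = trans (sym (+-assoc m j k)) (trans (cong (_+ k) (+-comm m j)) (+-assoc j m k))

Below9 : (ℕ → Set) → Set
Below9 P = ∀ {m} → m < 9 → P m

periodic : {P : ℕ → Set} → (∀ m → P (5 + m) → P (9 + m)) → Below9 P → ∀ m → P m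
periodic {P} step small = <-rec P go
  where
  go : ∀ m → (∀ {k} → k < m → P k) → P m
  go m rec with m <? 9
  ... | yes m<9 = small m<9
  ... | no m≮9 with m≤n⇒∃[o]m+o≡n (≮⇒≥ m≮9)
  ...   | k , refl = step k (rec (+-monoˡ-< k (<ᵇ⇒< 5 9 _)))

-- R m₁ t m₂ is meant at t = m₁ + m₂; keeping the sum abstract makes both shifts definitional for
-- the concrete families below.
periodic₂ : {R : ℕ → ℕ → ℕ → Set}
  → (∀ m₁ t m₂ → R (5 + m₁) (5 + t) m₂ → R (9 + m₁) (9 + t) m₂)
  → (∀ m₁ t m₂ → R m₁ (5 + t) (5 + m₂) → R m₁ (9 + t) (9 + m₂))
  → Below9 (λ m₁ → Below9 (λ m₂ → R m₁ (m₁ + m₂) m₂))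
  → ∀ m₁ m₂ → R m₁ (m₁ + m₂) m₂
periodic₂ {R} step₁ step₂ small =
  periodic (λ m₁ h m₂ → step₁ m₁ (m₁ + m₂) m₂ (h m₂)) (λ m₁<9 → periodic (step₂′ _) (small m₁<9))
  where
  step₂′ : ∀ m₁ k → R m₁ (m₁ + (5 + k)) (5 + k) → R m₁ (m₁ + (9 + k)) (9 + k)
  step₂′ m₁ k h = subst (λ t → R m₁ t (9 + k)) (sym (swap-+ m₁ 9 k))
                    (step₂ m₁ (m₁ + k) k (subst (λ t → R m₁ t (5 + k)) (swap-+ m₁ 5 k) h))

verify : (P : ℕ → Set) (P? : ∀ m → Dec (P m)) → (∀ m → P (5 + m) → P (9 + m))
  → True (allUpTo? P? 9) → ∀ m → P m
verify P P? step small = periodic step (toWitness small)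

verify₂ : (R : ℕ → ℕ → ℕ → Set) (R? : ∀ m₁ t m₂ → Dec (R m₁ t m₂))
  → (∀ m₁ t m₂ → R (5 + m₁) (5 + t) m₂ → R (9 + m₁) (9 + t) m₂)
  → (∀ m₁ t m₂ → R m₁ (5 + t) (5 + m₂) → R m₁ (9 + t) (9 + m₂))
  → True (allUpTo? (λ m₁ → allUpTo? (λ m₂ → R? m₁ (m₁ + m₂) m₂) 9) 9)
  → ∀ m₁ m₂ → R m₁ (m₁ + m₂) m₂
verify₂ R R? step₁ step₂ small = periodic₂ {R = R} step₁ step₂ (toWitness small)

isOdd : ℕ → Bool
isOdd zero = false
isOdd (suc zero) = true
isOdd (suc (suc n)) = isOdd n

isOdd-suc : ∀ n → isOdd (suc n) ≡ not (isOdd n)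
isOdd-suc zero = refl
isOdd-suc (suc zero) = refl
isOdd-suc (suc (suc n)) = isOdd-suc n

isOdd-+ : ∀ m n → isOdd (m + n) ≡ isOdd m xor isOdd n
isOdd-+ zero n = refl
isOdd-+ (suc zero) n = isOdd-suc n
isOdd-+ (suc (suc m)) n = isOdd-+ m n

isOdd-adjacent : ∀ n → isOdd n ≡ true → isOdd (suc n) ≡ true → ⊥
isOdd-adjacent zero () _
isOdd-adjacent (suc zero) _ ()
isOdd-adjacent (suc (suc n)) p q = isOdd-adjacent n p q

isOdd-double : ∀ n → isOdd (2 * n) ≡ false
isOdd-double zero = refl
isOdd-double (suc n) = trans (cong isOdd (*-suc 2 n)) (isOdd-double n)

isOdd⇒odd : ∀ n → isOdd n ≡ true → ∃ λ k → n ≡ 2 * k + 1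
isOdd⇒odd zero ()
isOdd⇒odd (suc zero) _ = 0 , refl
isOdd⇒odd (suc (suc n)) o with isOdd⇒odd n o
... | k , refl = suc k , sym (cong (_+ 1) (*-suc 2 k))

xor≡false⇒≡ : ∀ x y → x xor y ≡ false → x ≡ y
xor≡false⇒≡ false y e = sym e
xor≡false⇒≡ true false ()
xor≡false⇒≡ true true _ = refl

xor≡true⇒≡not : ∀ x y → x xor y ≡ true → x ≡ not y
xor≡true⇒≡not false .true refl = refl
xor≡true⇒≡not true false _ = refl
xor≡true⇒≡not true true ()

-- The value tables

⟦_∣_⟧ : Game → Game → Game
⟦ x ∣ y ⟧ = ⟨ x ∷ [] ∣ y ∷ [] ⟩

minusOne half oneStar twoStar : Game
minusOne = ⟨ [] ∣ zeroG ∷ [] ⟩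
half = ⟦ zeroG ∣ oneG ⟧
oneStar = ⟦ oneG ∣ oneG ⟧
twoStar = ⟦ twoG ∣ twoG ⟧

-- For the segments of column 1 from row a: combValue (isOdd a) m is the value when the m cells end
-- at most at row N, stemValue d when the d cells end at row N + 1, and hookValue hl hr d when they end
-- at row N + 2 with the hooks selected by hl and hr (see Segment below, with N even).
combValue : Bool → ℕ → Game
combValue b 0 = zeroG
combValue b 1 = if b then minusOne else zeroG
combValue b 2 = starG
combValue b 3 = if b then zeroG else starG
combValue b 4 = zeroG
combValue b 5 = if b then starG else zeroG
combValue b (suc (suc (suc (suc (suc (suc m)))))) = combValue b (suc (suc m))

stemValue : ℕ → Game
stemValue 0 = zeroG
stemValue 1 = zeroG
stemValue 2 = oneG
stemValue 3 = half
stemValue 4 = oneStar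
stemValue 5 = oneG
stemValue 6 = oneG
stemValue 7 = oneStar
stemValue (suc (suc (suc (suc (suc (suc (suc (suc m)))))))) = stemValue (suc (suc (suc (suc m))))

noHook oneHook twoHooks : ℕ → Game
noHook 0 = zeroG
noHook 1 = zeroG
noHook 2 = oneG
noHook 3 = oneG
noHook 4 = oneStar
noHook 5 = oneStar
noHook 6 = oneG
noHook 7 = oneG
noHook _ = oneStar
oneHook 0 = oneG
oneHook 1 = starG
oneHook 2 = ⟦ oneG ∣ zeroG ⟧
oneHook 3 = oneStar
oneHook 4 = ⟦ oneStar ∣ half ⟧
oneHook 5 = oneG
oneHook 6 = oneStar
oneHook 7 = oneStar
oneHook _ = oneG
twoHooks 0 = twoG
twoHooks 1 = zeroG
twoHooks 2 = ⟦ twoG ∣ oneG ⟧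
twoHooks 3 = twoStar
twoHooks 4 = ⟦ twoStar ∣ ⟦ oneG ∣ twoG ⟧ ⟧
twoHooks 5 = twoG
twoHooks 6 = twoStar
twoHooks 7 = twoStar
twoHooks _ = twoG

hookValue : Bool → Bool → ℕ → Game
hookValue hl hr (suc (suc (suc (suc (suc (suc (suc (suc (suc d))))))))) = hookValue hl hr (suc (suc (suc (suc (suc d)))))
hookValue false false d = noHook d
hookValue true true d = twoHooks d
hookValue _ _ d = oneHook d

-- Each fact depends on its arguments only through tables that are periodic with period 4 from 5 on,
-- so it is decided by evaluation below 9. L/R: no Left (Right) move of the segment reverses the
-- tabulated value; EL/ER: every Left (Right) option of the tabulated value is matched by a move.
≰? : {G H : Game} → Dec (¬ (G ≤G H))
≰? = ¬? (_ ≤G? _)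

all≤? : {us : List Game} {w : Game} → Dec (All (_≤G w) us)
all≤? {us} {w} = all? (_≤G? w) us

all≥? : {w : Game} {zs : List Game} → Dec (All (w ≤G_) zs)
all≥? {w} {zs} = all? (w ≤G?_) zs

CombL : Bool → ℕ → ℕ → ℕ → Set
CombL s m₁ t m₂ = ¬ (combValue s (2 + t) ≤G (combValue s m₁ +G combValue (s xor isOdd m₁) m₂))

combL : (s : Bool) (m1 m2 : ℕ) → CombL s m1 (m1 + m2) m2
combL false = verify₂ (CombL false) (λ _ _ _ → ≰?) (λ _ _ _ → id) (λ _ _ _ → id) _
combL true = verify₂ (CombL true) (λ _ _ _ → ≰?) (λ _ _ _ → id) (λ _ _ _ → id) _

CombR : Bool → ℕ → ℕ → ℕ → Set
CombR s m₁ t m₂ = s xor isOdd m₁ ≡ true → ¬ ((combValue s m₁ +G combValue false m₂) ≤G combValue s (1 + t))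

combR : (s : Bool) (m1 m2 : ℕ) → CombR s m1 (m1 + m2) m2
combR false = verify₂ (CombR false) (λ _ _ _ → _ Bool.≟ _ →-dec ≰?) (λ _ _ _ → id) (λ _ _ _ → id) _
combR true = verify₂ (CombR true) (λ _ _ _ → _ Bool.≟ _ →-dec ≰?) (λ _ _ _ → id) (λ _ _ _ → id) _

CombEL : Bool → ℕ → Set
CombEL s m = All (_≤G (combValue s 0 +G combValue s m)) (optL (combValue s (suc (suc m))))

combEL : (s : Bool) (m2 : ℕ) → CombEL s m2
combEL false = verify (CombEL false) (λ _ → all≤?) (λ _ → id) _
combEL true = verify (CombEL true) (λ _ → all≤?) (λ _ → id) _

CombER₀ : ℕ → Set
CombER₀ m = All ((combValue true 0 +G combValue false m) ≤G_) (optR (combValue true (suc m)))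

combER₀ : (m2 : ℕ) → CombER₀ m2
combER₀ = verify CombER₀ (λ _ → all≥?) (λ _ → id) _

CombER₁ : ℕ → Set
CombER₁ m = All ((combValue false 1 +G combValue false m) ≤G_) (optR (combValue false (suc (suc m))))

combER₁ : (m2 : ℕ) → CombER₁ m2
combER₁ = verify CombER₁ (λ _ → all≥?) (λ _ → id) _

StemL : ℕ → ℕ → ℕ → Set
StemL m₁ t m₂ = ¬ (stemValue (2 + t) ≤G (combValue (isOdd (2 + t)) m₁ +G stemValue m₂))

stemL : (m1 d2 : ℕ) → StemL m1 (m1 + d2) d2
stemL = verify₂ StemL (λ _ _ _ → ≰?) (λ _ _ _ → id) (λ _ _ _ → id) _

StemR : ℕ → ℕ → ℕ → Set
StemR m₁ t e = 2 ≤ e → isOdd e ≡ false → ¬ ((combValue (isOdd (1 + t)) m₁ +G stemValue e) ≤G stemValue (1 + t))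

stemR : (m1 d2 : ℕ) → isOdd d2 ≡ false → ¬ ((combValue (isOdd (suc (m1 + suc (suc d2)))) m1 +G stemValue (suc (suc d2))) ≤G stemValue (suc (m1 + suc (suc d2))))
stemR m1 d2 = verify₂ StemR (λ _ _ _ → 2 ≤? _ →-dec _ Bool.≟ _ →-dec ≰?) (λ _ _ _ → id) (λ _ _ _ h _ → h (s≤s (s≤s z≤n))) _
              m1 (2 + d2) (s≤s (s≤s z≤n))

StemEL : ℕ → Set
StemEL d = All (_≤G (combValue (isOdd (suc (suc d))) 0 +G stemValue d)) (optL (stemValue (suc (suc d))))

stemEL : (d2 : ℕ) → StemEL d2
stemEL = verify StemEL (λ _ → all≤?) (λ _ → id) _

StemER₀ : ℕ → Set
StemER₀ d = isOdd d ≡ false → All ((combValue true 0 +G stemValue (suc (suc d))) ≤G_) (optR (stemValue (suc (suc (suc d)))))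

stemER₀ : (d2 : ℕ) → StemER₀ d2
stemER₀ = verify StemER₀ (λ _ → _ Bool.≟ _ →-dec all≥?) (λ _ → id) _

StemER₁ : ℕ → Set
StemER₁ d = isOdd d ≡ false → All ((combValue false 1 +G stemValue (suc (suc d))) ≤G_) (optR (stemValue (suc (suc (suc (suc d))))))

stemER₁ : (d2 : ℕ) → StemER₁ d2
stemER₁ = verify StemER₁ (λ _ → _ Bool.≟ _ →-dec all≥?) (λ _ → id) _

HookedL : Bool → Bool → ℕ → ℕ → ℕ → Set
HookedL hl hr m₁ t m₂ = ¬ (hookValue hl hr (2 + t) ≤G (combValue (not (isOdd (2 + t))) m₁ +G hookValue hl hr m₂))

hookedL : (hl hr : Bool) (m1 d2 : ℕ) → HookedL hl hr m1 (m1 + d2) d2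
hookedL false false = verify₂ (HookedL false false) (λ _ _ _ → ≰?) (λ _ _ _ → id) (λ _ _ _ → id) _
hookedL false true = verify₂ (HookedL false true) (λ _ _ _ → ≰?) (λ _ _ _ → id) (λ _ _ _ → id) _
hookedL true false = verify₂ (HookedL true false) (λ _ _ _ → ≰?) (λ _ _ _ → id) (λ _ _ _ → id) _
hookedL true true = verify₂ (HookedL true true) (λ _ _ _ → ≰?) (λ _ _ _ → id) (λ _ _ _ → id) _

HookedR : Bool → Bool → ℕ → ℕ → ℕ → Set
HookedR hl hr m₁ t e = 3 ≤ e → isOdd e ≡ true → ¬ ((combValue (not (isOdd (1 + t))) m₁ +G hookValue hl hr e) ≤G hookValue hl hr (1 + t))

hookedR′ : (hl hr : Bool) (m1 e : ℕ) → HookedR hl hr m1 (m1 + e) e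
hookedR′ false false = verify₂ (HookedR false false) (λ _ _ _ → 3 ≤? _ →-dec _ Bool.≟ _ →-dec ≰?) (λ _ _ _ → id) (λ _ _ _ h _ → h (s≤s (s≤s (s≤s z≤n)))) _
hookedR′ false true = verify₂ (HookedR false true) (λ _ _ _ → 3 ≤? _ →-dec _ Bool.≟ _ →-dec ≰?) (λ _ _ _ → id) (λ _ _ _ h _ → h (s≤s (s≤s (s≤s z≤n)))) _
hookedR′ true false = verify₂ (HookedR true false) (λ _ _ _ → 3 ≤? _ →-dec _ Bool.≟ _ →-dec ≰?) (λ _ _ _ → id) (λ _ _ _ h _ → h (s≤s (s≤s (s≤s z≤n)))) _
hookedR′ true true = verify₂ (HookedR true true) (λ _ _ _ → 3 ≤? _ →-dec _ Bool.≟ _ →-dec ≰?) (λ _ _ _ → id) (λ _ _ _ h _ → h (s≤s (s≤s (s≤s z≤n)))) _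

hookedR : (hl hr : Bool) (m1 d2 : ℕ) → isOdd d2 ≡ false → ¬ ((combValue (not (isOdd (suc (m1 + suc (suc (suc d2)))))) m1 +G hookValue hl hr (suc (suc (suc d2)))) ≤G hookValue hl hr (suc (m1 + suc (suc (suc d2)))))
hookedR hl hr m1 d2 c = hookedR′ hl hr m1 (3 + d2) (s≤s (s≤s (s≤s z≤n))) (trans (isOdd-suc d2) (cong not c))

LeftHookL : Bool → ℕ → Set
LeftHookL hr d = ¬ (hookValue true hr d ≤G hookValue false hr d)

leftHookL : (hr : Bool) (d : ℕ) → LeftHookL hr d
leftHookL false = verify (LeftHookL false) (λ _ → ≰?) (λ _ → id) _
leftHookL true = verify (LeftHookL true) (λ _ → ≰?) (λ _ → id) _

RightHookL : Bool → ℕ → Set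
RightHookL hl d = ¬ (hookValue hl true d ≤G hookValue hl false d)

rightHookL : (hl : Bool) (d : ℕ) → RightHookL hl d
rightHookL false = verify (RightHookL false) (λ _ → ≰?) (λ _ → id) _
rightHookL true = verify (RightHookL true) (λ _ → ≰?) (λ _ → id) _

RowLeftR : Bool → ℕ → Set
RowLeftR hr d = ¬ ((stemValue d +G hookValue false hr 0) ≤G hookValue true hr (suc d))

rowLeftR : (hr : Bool) (d : ℕ) → RowLeftR hr d
rowLeftR false = verify (RowLeftR false) (λ _ → ≰?) (λ _ → id) _
rowLeftR true = verify (RowLeftR true) (λ _ → ≰?) (λ _ → id) _

RowRightR : Bool → ℕ → Set
RowRightR hl d = ¬ ((stemValue d +G hookValue hl false 0) ≤G hookValue hl true (suc d))

rowRightR : (hl : Bool) (d : ℕ) → RowRightR hl d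
rowRightR false = verify (RowRightR false) (λ _ → ≰?) (λ _ → id) _
rowRightR true = verify (RowRightR true) (λ _ → ≰?) (λ _ → id) _

NoHookEL : ℕ → Set
NoHookEL d = All (_≤G (combValue (not (isOdd (suc (suc d)))) 0 +G hookValue false false d)) (optL (hookValue false false (suc (suc d))))

noHookEL : (d2 : ℕ) → NoHookEL d2
noHookEL = verify NoHookEL (λ _ → all≤?) (λ _ → id) _

NoHookER₀ : ℕ → Set
NoHookER₀ d = isOdd d ≡ false → All ((combValue true 0 +G hookValue false false (suc (suc (suc d)))) ≤G_) (optR (hookValue false false (suc (suc (suc (suc d))))))

noHookER₀ : (d2 : ℕ) → NoHookER₀ d2
noHookER₀ = verify NoHookER₀ (λ _ → _ Bool.≟ _ →-dec all≥?) (λ _ → id) _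

NoHookER₁ : ℕ → Set
NoHookER₁ d = isOdd d ≡ false → All ((combValue false 1 +G hookValue false false (suc (suc (suc d)))) ≤G_) (optR (hookValue false false (suc (suc (suc (suc (suc d)))))))

noHookER₁ : (d2 : ℕ) → NoHookER₁ d2
noHookER₁ = verify NoHookER₁ (λ _ → _ Bool.≟ _ →-dec all≥?) (λ _ → id) _

LeftHookEL : ℕ → Set
LeftHookEL d = All (_≤G hookValue false false d) (optL (hookValue true false d))

leftHookEL : (d : ℕ) → LeftHookEL d
leftHookEL = verify LeftHookEL (λ _ → all≤?) (λ _ → id) _

RightHookEL : ℕ → Set
RightHookEL d = All (_≤G hookValue false false d) (optL (hookValue false true d))

rightHookEL : (d : ℕ) → RightHookEL d
rightHookEL = verify RightHookEL (λ _ → all≤?) (λ _ → id) _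

LeftHookER : ℕ → Set
LeftHookER d = All ((stemValue d +G hookValue false false 0) ≤G_) (optR (hookValue true false (suc d)))

leftHookER : (d : ℕ) → LeftHookER d
leftHookER = verify LeftHookER (λ _ → all≥?) (λ _ → id) _

RightHookER : ℕ → Set
RightHookER d = All ((stemValue d +G hookValue false false 0) ≤G_) (optR (hookValue false true (suc d)))

rightHookER : (d : ℕ) → RightHookER d
rightHookER = verify RightHookER (λ _ → all≥?) (λ _ → id) _

TwoHooksEL : ℕ → Set
TwoHooksEL d = All (_≤G (combValue (not (isOdd (suc (suc d)))) d +G hookValue true true 0)) (optL (hookValue true true (suc (suc d))))

twoHooksEL : (d : ℕ) → TwoHooksEL d
twoHooksEL = verify TwoHooksEL (λ _ → all≤?) (λ _ → id) _

TwoHooksER : ℕ → Set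
TwoHooksER d = All ((stemValue d +G hookValue false true 0) ≤G_) (optR (hookValue true true (suc d)))

twoHooksER : (d : ℕ) → TwoHooksER d
twoHooksER = verify TwoHooksER (λ _ → all≥?) (λ _ → id) _


-- The segments and their moves

module Geometry (N : ℕ) where

  hook₀ hook₁ : ℕ
  hook₀ = suc (suc N)
  hook₁ = suc hook₀

  -- Rows a ≤ y < e of column 1, the teeth (2, y) at odd rows of that range below N, and, if hl (hr)
  -- holds, the hook cells of column 0 (column 2) at rows N + 2 and N + 3. With N = 2n and a = 0,
  -- e = N + 3 and both hooks this is L_n^∪.
  Segment : ℕ → ℕ → Bool → Bool → Shape
  Segment a e hl hr 0 y = hl ≡ true × (y ≡ hook₀ ⊎ y ≡ hook₁)
  Segment a e hl hr 1 y = a ≤ y × y < e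
  Segment a e hl hr 2 y = (a ≤ y × y < e × y < N × isOdd y ≡ true) ⊎ (hr ≡ true × (y ≡ hook₀ ⊎ y ≡ hook₁))
  Segment a e hl hr (suc (suc (suc x))) y = ⊥

  false≢true : false ≡ true → ⊥
  false≢true ()

  N<hook₀ : N < hook₀
  N<hook₀ = ≤-trans (n<1+n N) (n≤1+n (suc N))

  data Vertical (a e : ℕ) (hl hr : Bool) : ℕ → ℕ → Set where
    column : ∀ {y} → a ≤ y → suc y < e → Vertical a e hl hr 1 y
    leftHook  : hl ≡ true → Vertical a e hl hr 0 hook₀
    rightHook  : hr ≡ true → Vertical a e hl hr 2 hook₀

  vertical : ∀ {a e hl hr} x y → e ≤ hook₁ → Segment a e hl hr x y → Segment a e hl hr x (suc y) → Vertical a e hl hr x y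
  vertical zero y le (h , inj₁ refl) (_ , inj₁ e) = ⊥-elim (<⇒≱ (n<1+n hook₀) (≤-reflexive e))
  vertical zero y le (h , inj₁ refl) (_ , inj₂ refl) = leftHook h
  vertical zero y le (h , inj₂ refl) (_ , inj₁ e) = ⊥-elim (<⇒≱ (≤-trans (n<1+n hook₀) (n≤1+n hook₁)) (≤-reflexive e))
  vertical zero y le (h , inj₂ refl) (_ , inj₂ e) = ⊥-elim (<⇒≱ (n<1+n hook₁) (≤-reflexive e))
  vertical 1 y le (p , _) (_ , q) = column p q
  vertical 2 y le (inj₁ (_ , _ , _ , o1)) (inj₁ (_ , _ , _ , o2)) = ⊥-elim (isOdd-adjacent y o1 o2)
  vertical 2 y le (inj₁ (_ , _ , yN , _)) (inj₂ (_ , inj₁ e)) = ⊥-elim (<⇒≱ yN (subst (N ≤_) (sym (cong Data.Nat.pred e)) (n≤1+n N)))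
  vertical 2 y le (inj₁ (_ , _ , yN , _)) (inj₂ (_ , inj₂ e)) = ⊥-elim (<⇒≱ yN (subst (N ≤_) (sym (cong Data.Nat.pred e)) (≤-trans (n≤1+n N) (n≤1+n (suc N)))))
  vertical 2 y le (inj₂ (_ , inj₁ refl)) (inj₁ (_ , _ , yN , _)) = ⊥-elim (<⇒≱ yN (≤-trans (n≤1+n N) (≤-trans (n≤1+n (suc N)) (n≤1+n hook₀))))
  vertical 2 y le (inj₂ (_ , inj₂ refl)) (inj₁ (_ , _ , yN , _)) = ⊥-elim (<⇒≱ yN (≤-trans (n≤1+n N) (≤-trans (n≤1+n (suc N)) (≤-trans (n≤1+n hook₀) (n≤1+n hook₁)))))
  vertical 2 y le (inj₂ (h , inj₁ refl)) (inj₂ (_ , inj₂ refl)) = rightHook h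
  vertical 2 y le (inj₂ (h , inj₁ refl)) (inj₂ (_ , inj₁ e)) = ⊥-elim (<⇒≱ (n<1+n hook₀) (≤-reflexive e))
  vertical 2 y le (inj₂ (h , inj₂ refl)) (inj₂ (_ , inj₁ e)) = ⊥-elim (<⇒≱ (≤-trans (n<1+n hook₀) (n≤1+n hook₁)) (≤-reflexive e))
  vertical 2 y le (inj₂ (h , inj₂ refl)) (inj₂ (_ , inj₂ e)) = ⊥-elim (<⇒≱ (n<1+n hook₁) (≤-reflexive e))

  data Horizontal (a e : ℕ) (hl hr : Bool) : ℕ → ℕ → Set where
    tooth : ∀ {y} → a ≤ y → y < e → y < N → isOdd y ≡ true → Horizontal a e hl hr 1 y
    rowLeft  : hl ≡ true → a ≤ hook₀ → hook₀ < e → Horizontal a e hl hr 0 hook₀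
    rowRight  : hr ≡ true → a ≤ hook₀ → hook₀ < e → Horizontal a e hl hr 1 hook₀

  horizontal : ∀ {a e hl hr} x y → e ≤ hook₁ → Segment a e hl hr x y → Segment a e hl hr (suc x) y → Horizontal a e hl hr x y
  horizontal zero y le (h , inj₁ refl) (p , q) = rowLeft h p q
  horizontal zero y le (h , inj₂ refl) (p , q) = ⊥-elim (<⇒≱ q le)
  horizontal 1 y le (p , q) (inj₁ (_ , _ , r , o)) = tooth p q r o
  horizontal 1 y le (p , q) (inj₂ (h , inj₁ refl)) = rowRight h p q
  horizontal 1 y le (p , q) (inj₂ (h , inj₂ refl)) = ⊥-elim (<⇒≱ q le)

  lt : ℕ → ℕ → Bool
  lt zero zero = false
  lt zero (suc r) = true
  lt (suc y) zero = false
  lt (suc y) (suc r) = lt y r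

  lt⇒< : ∀ {y r} → lt y r ≡ true → y < r
  lt⇒< {zero} {suc r} e = s≤s z≤n
  lt⇒< {suc y} {suc r} e = s≤s (lt⇒< {y} {r} e)
  lt⇒< {zero} {zero} ()
  lt⇒< {suc y} {zero} ()
  <⇒lt : ∀ {y r} → y < r → lt y r ≡ true
  <⇒lt {zero} {suc r} p = refl
  <⇒lt {suc y} {suc r} (s≤s p) = <⇒lt p
  ¬lt⇒≥ : ∀ {y r} → lt y r ≡ false → r ≤ y
  ¬lt⇒≥ {y} {zero} e = z≤n
  ¬lt⇒≥ {zero} {suc r} ()
  ¬lt⇒≥ {suc y} {suc r} e = s≤s (¬lt⇒≥ {y} {r} e)
  ≥⇒¬lt : ∀ {y r} → r ≤ y → lt y r ≡ false
  ≥⇒¬lt {zero} {zero} p = refl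
  ≥⇒¬lt {suc y} {zero} p = refl
  ≥⇒¬lt {suc y} {suc r} (s≤s p) = ≥⇒¬lt p

  below : ℕ → ℕ → ℕ → Bool
  below r x y = lt y r

  teethUpTo : ℕ → ℕ → ℕ → Bool
  teethUpTo r 2 y = lt y N ∧ lt y (suc (suc r))
  teethUpTo r _ y = false

  column₀ : ℕ → ℕ → Bool
  column₀ zero y = true
  column₀ (suc x) y = false

  column₂ : ℕ → ℕ → Bool
  column₂ 2 y = true
  column₂ _ y = false

  ≤-skip₂ : ∀ {r y} → r ≤ y → y ≢ r → y ≢ suc r → suc (suc r) ≤ y
  ≤-skip₂ {r} {y} p avoids-column n2 = ≤∧≢⇒< (≤∧≢⇒< p (λ e → avoids-column (sym e))) (λ e → n2 (sym e))

  ≤-skip₁ : ∀ {r y} → r ≤ y → y ≢ r → suc r ≤ y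
  ≤-skip₁ p n = ≤∧≢⇒< p (λ e → n (sym e))

  hook₀≤ : ∀ {y} → (y ≡ hook₀ ⊎ y ≡ hook₁) → hook₀ ≤ y
  hook₀≤ (inj₁ refl) = ≤-refl
  hook₀≤ (inj₂ refl) = n≤1+n hook₀

  <hook₀ : ∀ {r e} → suc (suc r) ≤ e → e ≤ hook₁ → r < hook₀
  <hook₀ p q = ≤-pred (≤-trans p q)

  AfterColumnMove : ℕ → ℕ → Bool → Bool → ℕ → Shape
  AfterColumnMove a e hl hr r x y = Segment a e hl hr x y × Avoids x y 1 r 1 (suc r)

  avoids-column : ∀ {x k y r : ℕ} → x ≢ k → ¬ (x ≡ k × y ≡ r)
  avoids-column n (e , _) = n e
  2≢1 : 2 ≢ 1
  2≢1 ()
  0≢1 : 0 ≢ 1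
  0≢1 ()

  -- Left's domino on (1, r), (1, r + 1) separates the segment below row r from the one above row
  -- r + 1; a tooth left at row r + 1 is isolated and contributes 0.
  module ColumnMove (a e : ℕ) (hl hr : Bool) (e≤hook₁ : e ≤ hook₁) (r : ℕ) (a≤r : a ≤ r) (2+r≤e : suc (suc r) ≤ e) where
    After : Shape
    After = AfterColumnMove a e hl hr r
    r<hook₀ : r < hook₀
    r<hook₀ = <hook₀ 2+r≤e e≤hook₁
    r<e : r < e
    r<e = ≤-trans (n≤1+n (suc r)) 2+r≤e

    respectsᵛ : ∀ x y → After x y → After x (suc y) → lt (suc y) r ≡ lt y r
    respectsᵛ x y (s1 , n1a , n1b) (s2 , n2a , n2b) with vertical x y e≤hook₁ s1 s2
    ... | column p q with lt y r in eq
    ...   | true = <⇒lt (≤∧≢⇒< (lt⇒< eq) (λ e → n2a (refl , e)))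
    ...   | false = ≥⇒¬lt (≤-trans (¬lt⇒≥ eq) (n≤1+n y))
    respectsᵛ x y _ _ | leftHook h = trans (≥⇒¬lt (≤-trans (<⇒≤ r<hook₀) (n≤1+n hook₀))) (sym (≥⇒¬lt (<⇒≤ r<hook₀)))
    respectsᵛ x y _ _ | rightHook h = trans (≥⇒¬lt (≤-trans (<⇒≤ r<hook₀) (n≤1+n hook₀))) (sym (≥⇒¬lt (<⇒≤ r<hook₀)))

    lower⁺ : ∀ x y → After x y × lt y r ≡ true → Segment a r false false x y
    lower⁺ zero y (((h , hy) , _) , l) = ⊥-elim (<⇒≱ (lt⇒< l) (≤-trans (<⇒≤ r<hook₀) (hook₀≤ hy)))
    lower⁺ 1 y (((p , q) , _) , l) = p , lt⇒< l
    lower⁺ 2 y ((inj₁ (p , q , t , o) , _) , l) = inj₁ (p , lt⇒< l , t , o)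
    lower⁺ 2 y ((inj₂ (h , hy) , _) , l) = ⊥-elim (<⇒≱ (lt⇒< l) (≤-trans (<⇒≤ r<hook₀) (hook₀≤ hy)))
    lower⁻ : ∀ x y → Segment a r false false x y → After x y × lt y r ≡ true
    lower⁻ zero y (() , _)
    lower⁻ 1 y (p , q) = ((p , <-trans q r<e) , (λ (_ , e) → <⇒≢ q e) , (λ (_ , e) → <⇒≢ (<-trans q (n<1+n r)) e)) , <⇒lt q
    lower⁻ 2 y (inj₁ (p , q , t , o)) = (inj₁ (p , <-trans q r<e , t , o) , avoids-column 2≢1 , avoids-column 2≢1) , <⇒lt q
    lower⁻ 2 y (inj₂ (() , _))

    Rest : Shape
    Rest x y = After x y × lt y r ≡ false

    respectsᵛ′ : ∀ x y → Rest x y → Rest x (suc y) → teethUpTo r x (suc y) ≡ teethUpTo r x y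
    respectsᵛ′ x y ((s1 , _) , _) ((s2 , _) , _) with vertical x y e≤hook₁ s1 s2
    ... | column p q = refl
    ... | leftHook h = refl
    ... | rightHook h rewrite ≥⇒¬lt {hook₀} {N} (<⇒≤ N<hook₀) | ≥⇒¬lt {suc hook₀} {N} (≤-trans (<⇒≤ N<hook₀) (n≤1+n hook₀)) = refl
    respectsʰ′ : ∀ x y → Rest x y → Rest (suc x) y → teethUpTo r (suc x) y ≡ teethUpTo r x y
    respectsʰ′ x y ((s1 , n1a , n1b) , l1) ((s2 , _) , _) with horizontal x y e≤hook₁ s1 s2
    ... | tooth p q t o rewrite <⇒lt t | ≥⇒¬lt {y} {suc (suc r)} (≤-skip₂ (¬lt⇒≥ l1) (λ e → n1a (refl , e)) (λ e → n1b (refl , e))) = refl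
    ... | rowLeft h p q = refl
    ... | rowRight h p q rewrite ≥⇒¬lt {hook₀} {N} (<⇒≤ N<hook₀) = refl

    Middle : Shape
    Middle x y = Rest x y × teethUpTo r x y ≡ true
    noVertical : ∀ x y → Middle x y → ¬ Middle x (suc y)
    noVertical x y (((s1 , _) , _) , m1) (((s2 , _) , _) , m2) with vertical x y e≤hook₁ s1 s2
    ... | column p q = false≢true m1
    ... | leftHook h = false≢true m1
    ... | rightHook h rewrite ≥⇒¬lt {hook₀} {N} (<⇒≤ N<hook₀) = false≢true m1
    noHorizontal : ∀ x y → Middle x y → ¬ Middle (suc x) y
    noHorizontal x y (((s1 , _) , _) , m1) (((s2 , _) , _) , m2) with horizontal x y e≤hook₁ s1 s2
    ... | tooth p q t o = false≢true m1
    ... | rowLeft h p q = false≢true m1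
    ... | rowRight h p q = false≢true m1

    Upper : Shape
    Upper x y = Rest x y × teethUpTo r x y ≡ false
    upper⁺ : ∀ x y → Upper x y → Segment (suc (suc r)) e hl hr x y
    upper⁺ zero y ((((h , hy) , _) , _) , _) = h , hy
    upper⁺ 1 y ((((p , q) , na , nb) , l) , _) = ≤-skip₂ (¬lt⇒≥ l) (λ e → na (refl , e)) (λ e → nb (refl , e)) , q
    upper⁺ 2 y (((inj₁ (p , q , t , o) , _) , l) , m) rewrite <⇒lt t = inj₁ (¬lt⇒≥ m , q , t , o)
    upper⁺ 2 y (((inj₂ hh , _) , l) , m) = inj₂ hh
    upper⁻ : ∀ x y → Segment (suc (suc r)) e hl hr x y → Upper x y
    upper⁻ zero y (h , hy) = (((h , hy) , avoids-column 0≢1 , avoids-column 0≢1) , ≥⇒¬lt (≤-trans (<⇒≤ r<hook₀) (hook₀≤ hy))) , refl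
    upper⁻ 1 y (p , q) = (((≤-trans a≤r (≤-trans (n≤1+n r) (≤-trans (n≤1+n (suc r)) p)) , q) ,
          (λ (_ , e) → <-irrefl (sym e) (≤-trans (n≤1+n (suc r)) p)) , (λ (_ , e) → <-irrefl (sym e) p)) ,
          ≥⇒¬lt (≤-trans (n≤1+n r) (≤-trans (n≤1+n (suc r)) p))) , refl
    upper⁻ 2 y (inj₁ (p , q , t , o)) rewrite <⇒lt t | ≥⇒¬lt p =
      ((inj₁ (≤-trans a≤r (≤-trans (n≤1+n r) (≤-trans (n≤1+n (suc r)) p)) , q , t , o) , avoids-column 2≢1 , avoids-column 2≢1) ,
       ≥⇒¬lt (≤-trans (n≤1+n r) (≤-trans (n≤1+n (suc r)) p))) , refl
    upper⁻ 2 y (inj₂ (h , hy)) rewrite ≥⇒¬lt {y} {N} (≤-trans (<⇒≤ N<hook₀) (hook₀≤ hy)) =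
      ((inj₂ (h , hy) , avoids-column 2≢1 , avoids-column 2≢1) , ≥⇒¬lt (≤-trans (<⇒≤ r<hook₀) (hook₀≤ hy))) , refl

    split : ∀ P → Realises (Segment a e hl hr) P →
      ∃₂ λ (L : Position) (U : Position) → Realises (Segment a r false false) L × Realises (Segment (suc (suc r)) e hl hr) U
        × domineering (rm2 up (cell 1 r) P) ≈G (domineering L +G domineering U)
    split P sp = L , U , realises-⇔ lower⁺ lower⁻ realisesL , realises-⇔ upper⁺ upper⁻ realisesU , splitting
      where
      Q = rm2 up (cell 1 r) P
      realisesQ : Realises After Q
      realisesQ = realises-rm2 up 1 r 1 (suc r) (up-cell 1 r) sp
      L = filterᵇ (onCells (below r)) Q
      R = filterᵇ (not ∘ onCells (below r)) Q
      M = filterᵇ (onCells (teethUpTo r)) R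
      U = filterᵇ (not ∘ onCells (teethUpTo r)) R
      realisesL = realises-filter (below r) realisesQ
      realisesR : Realises Rest R
      realisesR = realises-filter-not (below r) realisesQ
      realisesM = realises-filter (teethUpTo r) realisesR
      realisesU = realises-filter-not (teethUpTo r) realisesR
      splitting : domineering Q ≈G (domineering L +G domineering U)
      splitting = ≈G-trans (Split.domineering-split (onCells (below r)) Q (separates-byShape (below r) realisesQ respectsᵛ (λ x y _ _ → refl)))
             (+G-cong (≈G-refl _) (≈G-trans (Split.domineering-split (onCells (teethUpTo r)) R (separates-byShape (teethUpTo r) realisesR respectsᵛ′ respectsʰ′))
                (≈G-trans (+G-cong (realises-noMoves realisesM noVertical noHorizontal) (≈G-refl _)) (+G-identityˡ _))))

  module ToothMove (a e : ℕ) (hl hr : Bool) (e≤hook₁ : e ≤ hook₁) (r : ℕ) (a≤r : a ≤ r) (r<e : r < e) (rN : r < N) (odr : isOdd r ≡ true) where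
    After : Shape
    After x y = Segment a e hl hr x y × Avoids x y 1 r 2 r
    r<hook₀ : r < hook₀
    r<hook₀ = <-trans rN N<hook₀

    respectsᵛ : ∀ x y → After x y → After x (suc y) → lt (suc y) r ≡ lt y r
    respectsᵛ x y (s1 , n1a , n1b) (s2 , n2a , n2b) with vertical x y e≤hook₁ s1 s2
    ... | column p q with lt y r in eq
    ...   | true = <⇒lt (≤∧≢⇒< (lt⇒< eq) (λ e → n2a (refl , e)))
    ...   | false = ≥⇒¬lt (≤-trans (¬lt⇒≥ eq) (n≤1+n y))
    respectsᵛ x y _ _ | leftHook h = trans (≥⇒¬lt (≤-trans (<⇒≤ r<hook₀) (n≤1+n hook₀))) (sym (≥⇒¬lt (<⇒≤ r<hook₀)))
    respectsᵛ x y _ _ | rightHook h = trans (≥⇒¬lt (≤-trans (<⇒≤ r<hook₀) (n≤1+n hook₀))) (sym (≥⇒¬lt (<⇒≤ r<hook₀)))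

    lower⁺ : ∀ x y → After x y × lt y r ≡ true → Segment a r false false x y
    lower⁺ zero y (((h , hy) , _) , l) = ⊥-elim (<⇒≱ (lt⇒< l) (≤-trans (<⇒≤ r<hook₀) (hook₀≤ hy)))
    lower⁺ 1 y (((p , q) , _) , l) = p , lt⇒< l
    lower⁺ 2 y ((inj₁ (p , q , t , o) , _) , l) = inj₁ (p , lt⇒< l , t , o)
    lower⁺ 2 y ((inj₂ (h , hy) , _) , l) = ⊥-elim (<⇒≱ (lt⇒< l) (≤-trans (<⇒≤ r<hook₀) (hook₀≤ hy)))
    lower⁻ : ∀ x y → Segment a r false false x y → After x y × lt y r ≡ true
    lower⁻ zero y (() , _)
    lower⁻ 1 y (p , q) = ((p , <-trans q r<e) , (λ (_ , e) → <⇒≢ q e) , avoids-column (λ ())) , <⇒lt q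
    lower⁻ 2 y (inj₁ (p , q , t , o)) = (inj₁ (p , <-trans q r<e , t , o) , avoids-column 2≢1 , (λ (_ , e) → <⇒≢ q e)) , <⇒lt q
    lower⁻ 2 y (inj₂ (() , _))

    Upper : Shape
    Upper x y = After x y × lt y r ≡ false
    upper⁺ : ∀ x y → Upper x y → Segment (suc r) e hl hr x y
    upper⁺ zero y (((h , hy) , _) , _) = h , hy
    upper⁺ 1 y (((p , q) , na , nb) , l) = ≤-skip₁ (¬lt⇒≥ l) (λ e → na (refl , e)) , q
    upper⁺ 2 y ((inj₁ (p , q , t , o) , na , nb) , l) = inj₁ (≤-skip₁ (¬lt⇒≥ l) (λ e → nb (refl , e)) , q , t , o)
    upper⁺ 2 y ((inj₂ hh , _) , l) = inj₂ hh
    upper⁻ : ∀ x y → Segment (suc r) e hl hr x y → Upper x y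
    upper⁻ zero y (h , hy) = ((h , hy) , avoids-column 0≢1 , avoids-column (λ ())) , ≥⇒¬lt (≤-trans (<⇒≤ r<hook₀) (hook₀≤ hy))
    upper⁻ 1 y (p , q) = ((≤-trans a≤r (≤-trans (n≤1+n r) p) , q) , (λ (_ , e) → <-irrefl (sym e) p) , avoids-column (λ ())) , ≥⇒¬lt (≤-trans (n≤1+n r) p)
    upper⁻ 2 y (inj₁ (p , q , t , o)) = (inj₁ (≤-trans a≤r (≤-trans (n≤1+n r) p) , q , t , o) , avoids-column 2≢1 , (λ (_ , e) → <-irrefl (sym e) p)) , ≥⇒¬lt (≤-trans (n≤1+n r) p)
    upper⁻ 2 y (inj₂ (h , hy)) = (inj₂ (h , hy) , avoids-column 2≢1 , (λ (_ , e) → <-irrefl (sym e) (<-≤-trans r<hook₀ (hook₀≤ hy)))) , ≥⇒¬lt (≤-trans (<⇒≤ r<hook₀) (hook₀≤ hy))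

    split : ∀ P → Realises (Segment a e hl hr) P →
      ∃₂ λ (L : Position) (U : Position) → Realises (Segment a r false false) L × Realises (Segment (suc r) e hl hr) U
        × domineering (rm2 right (cell 1 r) P) ≈G (domineering L +G domineering U)
    split P sp = L , U , realises-⇔ lower⁺ lower⁻ realisesL , realises-⇔ upper⁺ upper⁻ realisesU , splitting
      where
      Q = rm2 right (cell 1 r) P
      realisesQ : Realises After Q
      realisesQ = realises-rm2 right 1 r 2 r (right-cell 1 r) sp
      L = filterᵇ (onCells (below r)) Q
      U = filterᵇ (not ∘ onCells (below r)) Q
      realisesL = realises-filter (below r) realisesQ
      realisesU = realises-filter-not (below r) realisesQ
      splitting : domineering Q ≈G (domineering L +G domineering U)
      splitting = Split.domineering-split (onCells (below r)) Q (separates-byShape (below r) realisesQ respectsᵛ (λ x y _ _ → refl))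

  module LeftHookMove (a e : ℕ) (hl hr : Bool) (hlt : hl ≡ true) where
    After : Shape
    After x y = Segment a e hl hr x y × Avoids x y 0 hook₀ 0 hook₁
    to : ∀ x y → After x y → Segment a e false hr x y
    to zero y ((h , inj₁ refl) , na , nb) = ⊥-elim (na (refl , refl))
    to zero y ((h , inj₂ refl) , na , nb) = ⊥-elim (nb (refl , refl))
    to 1 y (s , _) = s
    to 2 y (s , _) = s
    from : ∀ x y → Segment a e false hr x y → After x y
    from zero y (() , _)
    from 1 y s = s , (λ { (() , _) }) , (λ { (() , _) })
    from 2 y s = s , (λ { (() , _) }) , (λ { (() , _) })
    split : ∀ P → Realises (Segment a e hl hr) P → Realises (Segment a e false hr) (rm2 up (cell 0 hook₀) P)
    split P sp = realises-⇔ to from (realises-rm2 up 0 hook₀ 0 hook₁ (up-cell 0 hook₀) sp)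

  module RightHookMove (a e : ℕ) (hl hr : Bool) (hrt : hr ≡ true) where
    After : Shape
    After x y = Segment a e hl hr x y × Avoids x y 2 hook₀ 2 hook₁
    to : ∀ x y → After x y → Segment a e hl false x y
    to zero y (s , _) = s
    to 1 y (s , _) = s
    to 2 y (inj₁ t , _) = inj₁ t
    to 2 y (inj₂ (h , inj₁ refl) , na , nb) = ⊥-elim (na (refl , refl))
    to 2 y (inj₂ (h , inj₂ refl) , na , nb) = ⊥-elim (nb (refl , refl))
    from : ∀ x y → Segment a e hl false x y → After x y
    from zero y s = s , (λ { (() , _) }) , (λ { (() , _) })
    from 1 y s = s , (λ { (() , _) }) , (λ { (() , _) })
    from 2 y (inj₁ (p , q , t , o)) = inj₁ (p , q , t , o) , (λ (_ , e) → <⇒≱ t (subst (N ≤_) (sym e) (<⇒≤ N<hook₀))) , (λ (_ , e) → <⇒≱ t (subst (N ≤_) (sym e) (≤-trans (<⇒≤ N<hook₀) (n≤1+n hook₀))))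
    from 2 y (inj₂ (() , _))
    split : ∀ P → Realises (Segment a e hl hr) P → Realises (Segment a e hl false) (rm2 up (cell 2 hook₀) P)
    split P sp = realises-⇔ to from (realises-rm2 up 2 hook₀ 2 hook₁ (up-cell 2 hook₀) sp)

  ≡hook₀ : ∀ {y} → hook₀ ≤ y → y < hook₁ → y ≡ hook₀
  ≡hook₀ p q = ≤-antisym (≤-pred q) p

  lt-suc : ∀ y r → suc y ≢ r → lt (suc y) r ≡ lt y r
  lt-suc y r n with lt y r in eq
  ... | true = <⇒lt (≤∧≢⇒< (lt⇒< eq) n)
  ... | false = ≥⇒¬lt (≤-trans (¬lt⇒≥ eq) (n≤1+n y))

  module RowMoveLeft (a e : ℕ) (hl hr : Bool) (e≤hook₁ : e ≤ hook₁) (hlt : hl ≡ true) (≤hook₀ : a ≤ hook₀) (He : hook₀ < e) where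
    After : Shape
    After x y = Segment a e hl hr x y × Avoids x y 0 hook₀ 1 hook₀

    respectsᵛ : ∀ x y → After x y → After x (suc y) → lt (suc y) hook₀ ≡ lt y hook₀
    respectsᵛ x y (s1 , n1a , n1b) (s2 , n2a , n2b) with vertical x y e≤hook₁ s1 s2
    ... | column p q = lt-suc y hook₀ (λ e → n2b (refl , e))
    ... | leftHook h = ⊥-elim (n1a (refl , refl))
    ... | rightHook h = trans (≥⇒¬lt {suc hook₀} {hook₀} (n≤1+n hook₀)) (sym (≥⇒¬lt {hook₀} {hook₀} ≤-refl))

    lower⁺ : ∀ x y → After x y × lt y hook₀ ≡ true → Segment a hook₀ false false x y
    lower⁺ zero y (((h , hy) , _) , l) = ⊥-elim (<⇒≱ (lt⇒< l) (hook₀≤ hy))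
    lower⁺ 1 y (((p , q) , _) , l) = p , lt⇒< l
    lower⁺ 2 y ((inj₁ (p , q , t , o) , _) , l) = inj₁ (p , lt⇒< l , t , o)
    lower⁺ 2 y ((inj₂ (h , hy) , _) , l) = ⊥-elim (<⇒≱ (lt⇒< l) (hook₀≤ hy))
    lower⁻ : ∀ x y → Segment a hook₀ false false x y → After x y × lt y hook₀ ≡ true
    lower⁻ zero y (() , _)
    lower⁻ 1 y (p , q) = ((p , <-trans q He) , avoids-column (λ ()) , (λ (_ , e) → <⇒≢ q e)) , <⇒lt q
    lower⁻ 2 y (inj₁ (p , q , t , o)) = (inj₁ (p , <-trans q He , t , o) , avoids-column (λ ()) , avoids-column (λ ())) , <⇒lt q
    lower⁻ 2 y (inj₂ (() , _))

    Rest : Shape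
    Rest x y = After x y × lt y hook₀ ≡ false
    respectsʰ′ : ∀ x y → Rest x y → Rest (suc x) y → column₀ (suc x) y ≡ column₀ x y
    respectsʰ′ x y ((s1 , n1a , n1b) , l1) ((s2 , n2a , n2b) , _) with horizontal x y e≤hook₁ s1 s2
    ... | tooth p q t o = refl
    ... | rowLeft h p q = ⊥-elim (n1a (refl , refl))
    ... | rowRight h p q = refl

    Middle : Shape
    Middle x y = Rest x y × column₀ x y ≡ true
    noVertical : ∀ x y → Middle x y → ¬ Middle x (suc y)
    noVertical x y (((s1 , n1a , _) , _) , m1) (((s2 , _) , _) , m2) with vertical x y e≤hook₁ s1 s2
    ... | column p q = false≢true m1
    ... | leftHook h = n1a (refl , refl)
    ... | rightHook h = false≢true m1
    noHorizontal : ∀ x y → Middle x y → ¬ Middle (suc x) y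
    noHorizontal x y _ (_ , m2) = false≢true m2

    Upper : Shape
    Upper x y = Rest x y × column₀ x y ≡ false
    upper⁺ : ∀ x y → Upper x y → Segment hook₁ hook₁ false hr x y
    upper⁺ zero y (_ , ())
    upper⁺ 1 y ((((p , q) , na , nb) , l) , _) = ⊥-elim (nb (refl , ≡hook₀ (¬lt⇒≥ l) (≤-trans q e≤hook₁)))
    upper⁺ 2 y (((inj₁ (p , q , t , o) , _) , l) , _) = ⊥-elim (<⇒≱ t (≤-trans (<⇒≤ N<hook₀) (¬lt⇒≥ l)))
    upper⁺ 2 y (((inj₂ hh , _) , l) , _) = inj₂ hh
    upper⁻ : ∀ x y → Segment hook₁ hook₁ false hr x y → Upper x y
    upper⁻ zero y (() , _)
    upper⁻ 1 y (p , q) = ⊥-elim (<⇒≱ q p)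
    upper⁻ 2 y (inj₁ (p , q , _)) = ⊥-elim (<⇒≱ q p)
    upper⁻ 2 y (inj₂ (h , hy)) = ((inj₂ (h , hy) , avoids-column (λ ()) , avoids-column (λ ())) , ≥⇒¬lt (hook₀≤ hy)) , refl

    split : ∀ P → Realises (Segment a e hl hr) P →
      ∃₂ λ (L : Position) (U : Position) → Realises (Segment a hook₀ false false) L × Realises (Segment hook₁ hook₁ false hr) U
        × domineering (rm2 right (cell 0 hook₀) P) ≈G (domineering L +G domineering U)
    split P sp = L , U , realises-⇔ lower⁺ lower⁻ realisesL , realises-⇔ upper⁺ upper⁻ realisesU , splitting
      where
      Q = rm2 right (cell 0 hook₀) P
      realisesQ : Realises After Q
      realisesQ = realises-rm2 right 0 hook₀ 1 hook₀ (right-cell 0 hook₀) sp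
      L = filterᵇ (onCells (below hook₀)) Q
      R = filterᵇ (not ∘ onCells (below hook₀)) Q
      M = filterᵇ (onCells column₀) R
      U = filterᵇ (not ∘ onCells column₀) R
      realisesL = realises-filter (below hook₀) realisesQ
      realisesR : Realises Rest R
      realisesR = realises-filter-not (below hook₀) realisesQ
      realisesM = realises-filter column₀ realisesR
      realisesU = realises-filter-not column₀ realisesR
      splitting : domineering Q ≈G (domineering L +G domineering U)
      splitting = ≈G-trans (Split.domineering-split (onCells (below hook₀)) Q (separates-byShape (below hook₀) realisesQ respectsᵛ (λ x y _ _ → refl)))
             (+G-cong (≈G-refl _) (≈G-trans (Split.domineering-split (onCells column₀) R (separates-byShape column₀ realisesR (λ x y _ _ → refl) respectsʰ′))
                (≈G-trans (+G-cong (realises-noMoves realisesM noVertical noHorizontal) (≈G-refl _)) (+G-identityˡ _))))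

  module RowMoveRight (a e : ℕ) (hl hr : Bool) (e≤hook₁ : e ≤ hook₁) (hrt : hr ≡ true) (≤hook₀ : a ≤ hook₀) (He : hook₀ < e) where
    After : Shape
    After x y = Segment a e hl hr x y × Avoids x y 1 hook₀ 2 hook₀

    respectsᵛ : ∀ x y → After x y → After x (suc y) → lt (suc y) hook₀ ≡ lt y hook₀
    respectsᵛ x y (s1 , n1a , n1b) (s2 , n2a , n2b) with vertical x y e≤hook₁ s1 s2
    ... | column p q = lt-suc y hook₀ (λ e → n2a (refl , e))
    ... | leftHook h = trans (≥⇒¬lt {suc hook₀} {hook₀} (n≤1+n hook₀)) (sym (≥⇒¬lt {hook₀} {hook₀} ≤-refl))
    ... | rightHook h = ⊥-elim (n1b (refl , refl))

    lower⁺ : ∀ x y → After x y × lt y hook₀ ≡ true → Segment a hook₀ false false x y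
    lower⁺ zero y (((h , hy) , _) , l) = ⊥-elim (<⇒≱ (lt⇒< l) (hook₀≤ hy))
    lower⁺ 1 y (((p , q) , _) , l) = p , lt⇒< l
    lower⁺ 2 y ((inj₁ (p , q , t , o) , _) , l) = inj₁ (p , lt⇒< l , t , o)
    lower⁺ 2 y ((inj₂ (h , hy) , _) , l) = ⊥-elim (<⇒≱ (lt⇒< l) (hook₀≤ hy))
    lower⁻ : ∀ x y → Segment a hook₀ false false x y → After x y × lt y hook₀ ≡ true
    lower⁻ zero y (() , _)
    lower⁻ 1 y (p , q) = ((p , <-trans q He) , (λ (_ , e) → <⇒≢ q e) , avoids-column (λ ())) , <⇒lt q
    lower⁻ 2 y (inj₁ (p , q , t , o)) = (inj₁ (p , <-trans q He , t , o) , avoids-column (λ ()) , (λ (_ , e) → <⇒≢ q e)) , <⇒lt q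
    lower⁻ 2 y (inj₂ (() , _))

    Rest : Shape
    Rest x y = After x y × lt y hook₀ ≡ false
    respectsʰ′ : ∀ x y → Rest x y → Rest (suc x) y → column₂ (suc x) y ≡ column₂ x y
    respectsʰ′ x y ((s1 , n1a , n1b) , l1) ((s2 , n2a , n2b) , _) with horizontal x y e≤hook₁ s1 s2
    ... | tooth p q t o = ⊥-elim (<⇒≱ t (≤-trans (<⇒≤ N<hook₀) (¬lt⇒≥ l1)))
    ... | rowLeft h p q = refl
    ... | rowRight h p q = ⊥-elim (n1a (refl , refl))

    Middle : Shape
    Middle x y = Rest x y × column₂ x y ≡ true
    noVertical : ∀ x y → Middle x y → ¬ Middle x (suc y)
    noVertical x y (((s1 , _ , n1b) , _) , m1) (((s2 , _) , _) , m2) with vertical x y e≤hook₁ s1 s2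
    ... | column p q = false≢true m1
    ... | leftHook h = false≢true m1
    ... | rightHook h = n1b (refl , refl)
    noHorizontal : ∀ x y → Middle x y → ¬ Middle (suc x) y
    noHorizontal 2 y _ (_ , m2) = false≢true m2
    noHorizontal zero y (_ , m1) _ = false≢true m1
    noHorizontal 1 y (_ , m1) _ = false≢true m1
    noHorizontal (suc (suc (suc x))) y (_ , m1) _ = false≢true m1

    Upper : Shape
    Upper x y = Rest x y × column₂ x y ≡ false
    upper⁺ : ∀ x y → Upper x y → Segment hook₁ hook₁ hl false x y
    upper⁺ zero y ((((h , hy) , _) , _) , _) = h , hy
    upper⁺ 1 y ((((p , q) , na , nb) , l) , _) = ⊥-elim (na (refl , ≡hook₀ (¬lt⇒≥ l) (≤-trans q e≤hook₁)))
    upper⁺ 2 y (_ , ())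
    upper⁻ : ∀ x y → Segment hook₁ hook₁ hl false x y → Upper x y
    upper⁻ zero y (h , hy) = (((h , hy) , avoids-column (λ ()) , avoids-column (λ ())) , ≥⇒¬lt (hook₀≤ hy)) , refl
    upper⁻ 1 y (p , q) = ⊥-elim (<⇒≱ q p)
    upper⁻ 2 y (inj₁ (p , q , _)) = ⊥-elim (<⇒≱ q p)
    upper⁻ 2 y (inj₂ (() , _))

    split : ∀ P → Realises (Segment a e hl hr) P →
      ∃₂ λ (L : Position) (U : Position) → Realises (Segment a hook₀ false false) L × Realises (Segment hook₁ hook₁ hl false) U
        × domineering (rm2 right (cell 1 hook₀) P) ≈G (domineering L +G domineering U)
    split P sp = L , U , realises-⇔ lower⁺ lower⁻ realisesL , realises-⇔ upper⁺ upper⁻ realisesU , splitting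
      where
      Q = rm2 right (cell 1 hook₀) P
      realisesQ : Realises After Q
      realisesQ = realises-rm2 right 1 hook₀ 2 hook₀ (right-cell 1 hook₀) sp
      L = filterᵇ (onCells (below hook₀)) Q
      R = filterᵇ (not ∘ onCells (below hook₀)) Q
      M = filterᵇ (onCells column₂) R
      U = filterᵇ (not ∘ onCells column₂) R
      realisesL = realises-filter (below hook₀) realisesQ
      realisesR : Realises Rest R
      realisesR = realises-filter-not (below hook₀) realisesQ
      realisesM = realises-filter column₂ realisesR
      realisesU = realises-filter-not column₂ realisesR
      splitting : domineering Q ≈G (domineering L +G domineering U)
      splitting = ≈G-trans (Split.domineering-split (onCells (below hook₀)) Q (separates-byShape (below hook₀) realisesQ respectsᵛ (λ x y _ _ → refl)))
             (+G-cong (≈G-refl _) (≈G-trans (Split.domineering-split (onCells column₂) R (separates-byShape column₂ realisesR (λ x y _ _ → refl) respectsʰ′))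
                (≈G-trans (+G-cong (realises-noMoves realisesM noVertical noHorizontal) (≈G-refl _)) (+G-identityˡ _))))

  data LeftMove (a e : ℕ) (hl hr : Bool) (P : Position) (x : Game) : Set where
    lcolumn : ∀ r → a ≤ r → suc (suc r) ≤ e → x ≡ domineering (rm2 up (cell 1 r) P) → LeftMove a e hl hr P x
    lleftHook : hl ≡ true → x ≡ domineering (rm2 up (cell 0 hook₀) P) → LeftMove a e hl hr P x
    lrightHook : hr ≡ true → x ≡ domineering (rm2 up (cell 2 hook₀) P) → LeftMove a e hl hr P x

  leftMove-cases : ∀ {a e hl hr P x} → e ≤ hook₁ → Realises (Segment a e hl hr) P → x ∈ optL (domineering P) → LeftMove a e hl hr P x
  leftMove-cases {a} {e} {hl} {hr} {P} e≤hook₁ sp m with optL-dom⁻ P m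
  ... | Q , (c , m1 , m2 , refl) , refl with realises-up sp m1 m2
  ... | x , y , refl , s1 , s2 with vertical x y e≤hook₁ s1 s2
  ... | column p q = lcolumn y p q refl
  ... | leftHook h = lleftHook h refl
  ... | rightHook h = lrightHook h refl

  data RightMove (a e : ℕ) (hl hr : Bool) (P : Position) (x : Game) : Set where
    rtooth : ∀ r → a ≤ r → r < e → r < N → isOdd r ≡ true → x ≡ domineering (rm2 right (cell 1 r) P) → RightMove a e hl hr P x
    rrowLeft : hl ≡ true → a ≤ hook₀ → hook₀ < e → x ≡ domineering (rm2 right (cell 0 hook₀) P) → RightMove a e hl hr P x
    rrowRight : hr ≡ true → a ≤ hook₀ → hook₀ < e → x ≡ domineering (rm2 right (cell 1 hook₀) P) → RightMove a e hl hr P x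

  rightMove-cases : ∀ {a e hl hr P x} → e ≤ hook₁ → Realises (Segment a e hl hr) P → x ∈ optR (domineering P) → RightMove a e hl hr P x
  rightMove-cases {a} {e} {hl} {hr} {P} e≤hook₁ sp m with optR-dom⁻ P m
  ... | Q , (c , m1 , m2 , refl) , refl with realises-right sp m1 m2
  ... | x , y , refl , s1 , s2 with horizontal x y e≤hook₁ s1 s2
  ... | tooth p q t o = rtooth y p q t o refl
  ... | rowLeft h p q = rrowLeft h p q refl
  ... | rowRight h p q = rrowRight h p q refl

  inP : ∀ {a e hl hr P} x y → Realises (Segment a e hl hr) P → Segment a e hl hr x y → cell x y ∈ P
  inP x y sp s = proj₂ sp x y s

  columnMove∈optL : ∀ {a e hl hr P} r → Realises (Segment a e hl hr) P → a ≤ r → suc (suc r) ≤ e → domineering (rm2 up (cell 1 r) P) ∈ optL (domineering P)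
  columnMove∈optL {a} {e} {hl} {hr} {P} r sp p q = optL-dom⁺ P (cell 1 r) (inP 1 r sp (p , ≤-trans (n≤1+n (suc r)) q))
    (subst (_∈ P) (sym (up-cell 1 r)) (inP 1 (suc r) sp (≤-trans p (n≤1+n r) , q)))

  leftHookMove∈optL : ∀ {a e hl hr P} → Realises (Segment a e hl hr) P → hl ≡ true → domineering (rm2 up (cell 0 hook₀) P) ∈ optL (domineering P)
  leftHookMove∈optL {P = P} sp h = optL-dom⁺ P (cell 0 hook₀) (inP 0 hook₀ sp (h , inj₁ refl)) (subst (_∈ P) (sym (up-cell 0 hook₀)) (inP 0 hook₁ sp (h , inj₂ refl)))
  rightHookMove∈optL : ∀ {a e hl hr P} → Realises (Segment a e hl hr) P → hr ≡ true → domineering (rm2 up (cell 2 hook₀) P) ∈ optL (domineering P)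
  rightHookMove∈optL {P = P} sp h = optL-dom⁺ P (cell 2 hook₀) (inP 2 hook₀ sp (inj₂ (h , inj₁ refl))) (subst (_∈ P) (sym (up-cell 2 hook₀)) (inP 2 hook₁ sp (inj₂ (h , inj₂ refl))))

  toothMove∈optR : ∀ {a e hl hr P} r → Realises (Segment a e hl hr) P → a ≤ r → r < e → r < N → isOdd r ≡ true → domineering (rm2 right (cell 1 r) P) ∈ optR (domineering P)
  toothMove∈optR {P = P} r sp p q t o = optR-dom⁺ P (cell 1 r) (inP 1 r sp (p , q)) (subst (_∈ P) (sym (right-cell 1 r)) (inP 2 r sp (inj₁ (p , q , t , o))))
  rowMoveLeft∈optR : ∀ {a e hl hr P} → Realises (Segment a e hl hr) P → hl ≡ true → a ≤ hook₀ → hook₀ < e → domineering (rm2 right (cell 0 hook₀) P) ∈ optR (domineering P)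
  rowMoveLeft∈optR {P = P} sp h p q = optR-dom⁺ P (cell 0 hook₀) (inP 0 hook₀ sp (h , inj₁ refl)) (subst (_∈ P) (sym (right-cell 0 hook₀)) (inP 1 hook₀ sp (p , q)))
  rowMoveRight∈optR : ∀ {a e hl hr P} → Realises (Segment a e hl hr) P → hr ≡ true → a ≤ hook₀ → hook₀ < e → domineering (rm2 right (cell 1 hook₀) P) ∈ optR (domineering P)
  rowMoveRight∈optR {P = P} sp h p q = optR-dom⁺ P (cell 1 hook₀) (inP 1 hook₀ sp (p , q)) (subst (_∈ P) (sym (right-cell 1 hook₀)) (inP 2 hook₀ sp (inj₂ (h , inj₁ refl))))


-- By induction on the length, using ≈G-byOptions: every option of a segment is a sum of segments that
-- are shorter or have fewer hooks, whose values are known, and the verified table facts finish.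
module Values (N : ℕ) (isOdd-N : isOdd N ≡ false) where


  open Geometry N

  ≤⇒+ : ∀ {a r} → a ≤ r → ∃ λ (m1 : ℕ) → r ≡ a + m1
  ≤⇒+ p = let (k , e) = m≤n⇒∃[o]m+o≡n p in k , sym e

  split-columnMove : ∀ {a m r} → a ≤ r → suc (suc r) ≤ a + m → ∃₂ λ (m1 : ℕ) (m2 : ℕ) → r ≡ a + m1 × m ≡ suc (suc (m1 + m2))
  split-columnMove {a} {m} {r} p q with ≤⇒+ p | ≤⇒+ q
  ... | m1 , refl | m2 , e = m1 , m2 , refl , +-cancelˡ-≡ a m (suc (suc (m1 + m2))) (sym (begin
        a + suc (suc (m1 + m2))   ≡⟨ +-suc a (suc (m1 + m2)) ⟩
        suc (a + suc (m1 + m2))   ≡⟨ cong suc (+-suc a (m1 + m2)) ⟩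
        suc (suc (a + (m1 + m2))) ≡⟨ cong (λ z → suc (suc z)) (sym (+-assoc a m1 m2)) ⟩
        suc (suc (a + m1 + m2))   ≡⟨ sym e ⟩
        a + m ∎))
    where open ≡-Reasoning

  split-toothMove : ∀ {a m r} → a ≤ r → r < a + m → ∃₂ λ (m1 : ℕ) (m2 : ℕ) → r ≡ a + m1 × m ≡ suc (m1 + m2)
  split-toothMove {a} {m} {r} p q with ≤⇒+ p | ≤⇒+ q
  ... | m1 , refl | m2 , e = m1 , m2 , refl , +-cancelˡ-≡ a m (suc (m1 + m2)) (sym (begin
        a + suc (m1 + m2)   ≡⟨ +-suc a (m1 + m2) ⟩
        suc (a + (m1 + m2)) ≡⟨ cong suc (sym (+-assoc a m1 m2)) ⟩
        suc (a + m1 + m2)   ≡⟨ sym e ⟩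
        a + m ∎))
    where open ≡-Reasoning

  ≰-via-≈ʳ : ∀ {v x w} → x ≈G w → ¬ (v ≤G w) → ¬ (v ≤G x)
  ≰-via-≈ʳ (a , b) n h = n (≤G-trans h a)
  ≰-via-≈ˡ : ∀ {v y w} → y ≈G w → ¬ (w ≤G v) → ¬ (y ≤G v)
  ≰-via-≈ˡ (a , b) n h = n (≤G-trans b h)
  ≤-via-≈ʳ : ∀ {u x w} → x ≈G w → u ≤G w → u ≤G x
  ≤-via-≈ʳ (a , b) h = ≤G-trans h b
  ≤-via-≈ˡ : ∀ {z y w} → y ≈G w → w ≤G z → y ≤G z
  ≤-via-≈ˡ (a , b) h = ≤G-trans a h

  realises-end : ∀ {a e e' hl hr P} → e ≡ e' → Realises (Segment a e hl hr) P → Realises (Segment a e' hl hr) P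
  realises-end refl s = s
  N<hook₁ : suc N ≤ hook₁
  N<hook₁ = ≤-trans (n≤1+n (suc N)) (n≤1+n hook₀)

  plus2 : ∀ a m1 m2 → a + suc (suc (m1 + m2)) ≡ suc (suc (a + m1 + m2))
  plus2 a m1 m2 = trans (+-suc a (suc (m1 + m2))) (cong suc (trans (+-suc a (m1 + m2)) (cong suc (sym (+-assoc a m1 m2)))))
  plus1 : ∀ a m1 m2 → a + suc (m1 + m2) ≡ suc (a + m1 + m2)
  plus1 a m1 m2 = trans (+-suc a (m1 + m2)) (cong suc (sym (+-assoc a m1 m2)))

  ≤S2 : ∀ x y → x ≤ suc (suc (x + y))
  ≤S2 x y = ≤-trans (m≤m+n x y) (≤-trans (n≤1+n _) (n≤1+n _))
  ≤S1 : ∀ x y → x ≤ suc (x + y)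
  ≤S1 x y = ≤-trans (m≤m+n x y) (n≤1+n _)

  m1<2 : ∀ m1 m2 → m1 < suc (suc (m1 + m2))
  m1<2 m1 m2 = s≤s (≤-trans (m≤m+n m1 m2) (n≤1+n _))
  m2<2 : ∀ m1 m2 → m2 < suc (suc (m1 + m2))
  m2<2 m1 m2 = s≤s (≤-trans (≤-trans (m≤m+n m2 m1) (≤-reflexive (+-comm m2 m1))) (n≤1+n _))
  m1<1 : ∀ m1 m2 → m1 < suc (m1 + m2)
  m1<1 m1 m2 = s≤s (m≤m+n m1 m2)
  m2<1 : ∀ m1 m2 → m2 < suc (m1 + m2)
  m2<1 m1 m2 = s≤s (≤-trans (m≤m+n m2 m1) (≤-reflexive (+-comm m2 m1)))

  CombValue : ℕ → Set
  CombValue m = ∀ a P → a + m ≤ suc N → Realises (Segment a (a + m) false false) P → domineering P ≈G combValue (isOdd a) m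

  comb-columnMove : ∀ m1 m2 a r P → a + m1 ≡ r → (∀ m' → m' < suc (suc (m1 + m2)) → CombValue m') → a + suc (suc (m1 + m2)) ≤ suc N
    → Realises (Segment a (a + suc (suc (m1 + m2))) false false) P
    → domineering (rm2 up (cell 1 r) P) ≈G (combValue (isOdd a) m1 +G combValue (isOdd a xor isOdd m1) m2)
  comb-columnMove m1 m2 a .(a + m1) P refl IH bnd sp =
    let (L , U , spL , spU , eqv) = ColumnMove.split a (a + suc (suc (m1 + m2))) false false (≤-trans bnd N<hook₁) (a + m1) (m≤m+n a m1) (≤-trans (s≤s (s≤s (m≤m+n (a + m1) m2))) (≤-reflexive (sym (plus2 a m1 m2)))) P sp
    in
    ≈G-trans eqv (+G-cong (IH m1 (m1<2 m1 m2) a L (≤-trans (≤-trans (≤S2 (a + m1) m2) (≤-reflexive (sym (plus2 a m1 m2)))) bnd) spL)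
                         (subst (λ b → domineering U ≈G combValue b m2) (isOdd-+ a m1)
                            (IH m2 (m2<2 m1 m2) (suc (suc (a + m1))) U (≤-trans (≤-reflexive (sym (plus2 a m1 m2))) bnd) (realises-end (plus2 a m1 m2) spU))))

  comb-toothMove : ∀ m1 m2 a r P → a + m1 ≡ r → (∀ m' → m' < suc (m1 + m2) → CombValue m') → a + suc (m1 + m2) ≤ suc N
    → Realises (Segment a (a + suc (m1 + m2)) false false) P → r < N → isOdd r ≡ true
    → domineering (rm2 right (cell 1 r) P) ≈G (combValue (isOdd a) m1 +G combValue false m2)
  comb-toothMove m1 m2 a .(a + m1) P refl IH bnd sp rN odr =
    let (L , U , spL , spU , eqv) = ToothMove.split a (a + suc (m1 + m2)) false false (≤-trans bnd N<hook₁) (a + m1) (m≤m+n a m1) (≤-trans (s≤s (m≤m+n (a + m1) m2)) (≤-reflexive (sym (plus1 a m1 m2)))) rN odr P sp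
    in
    ≈G-trans eqv (+G-cong (IH m1 (m1<1 m1 m2) a L (≤-trans (≤-trans (≤S1 (a + m1) m2) (≤-reflexive (sym (plus1 a m1 m2)))) bnd) spL)
                         (subst (λ b → domineering U ≈G combValue b m2) (trans (isOdd-suc (a + m1)) (cong not odr))
                            (IH m2 (m2<1 m1 m2) (suc (a + m1)) U (≤-trans (≤-reflexive (sym (plus1 a m1 m2))) bnd) (realises-end (plus1 a m1 m2) spU))))

  plusS2 : ∀ a m → a + suc (suc m) ≡ suc (suc (a + m))
  plusS2 a m = trans (+-suc a (suc m)) (cong suc (+-suc a m))
  plusS1 : ∀ a m → a + suc m ≡ suc (a + m)
  plusS1 a m = +-suc a m

  isOdd⇒≢N : ∀ {r} → isOdd r ≡ true → r ≢ N
  isOdd⇒≢N o refl = not-¬ o isOdd-N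

  isOdd⇒<N : ∀ {r} → isOdd r ≡ true → r ≤ N → r < N
  isOdd⇒<N o p = ≤∧≢⇒< p (isOdd⇒≢N o)

  CombValueBelow : ℕ → Set
  CombValueBelow m = ∀ m' → m' < m → CombValue m'

  comb-optL-≱ : ∀ m a P → CombValueBelow m → a + m ≤ suc N → Realises (Segment a (a + m) false false) P → ∀ x → x ∈ optL (domineering P) → ¬ (combValue (isOdd a) m ≤G x)
  comb-optL-≱ m a P IH bnd sp x mx with leftMove-cases (≤-trans bnd N<hook₁) sp mx
  ... | lcolumn r ar re refl with split-columnMove {a} {m} ar re
  ...   | m1 , m2 , refl , refl = ≰-via-≈ʳ (comb-columnMove m1 m2 a (a + m1) P refl IH bnd sp) (combL (isOdd a) m1 m2)
  comb-optL-≱ m a P IH bnd sp x mx | lleftHook () _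
  comb-optL-≱ m a P IH bnd sp x mx | lrightHook () _

  comb-optR-≰ : ∀ m a P → CombValueBelow m → a + m ≤ suc N → Realises (Segment a (a + m) false false) P → ∀ y → y ∈ optR (domineering P) → ¬ (y ≤G combValue (isOdd a) m)
  comb-optR-≰ m a P IH bnd sp y my with rightMove-cases (≤-trans bnd N<hook₁) sp my
  ... | rtooth r ar re rN odr refl with split-toothMove {a} {m} ar re
  ...   | m1 , m2 , refl , refl = ≰-via-≈ˡ (comb-toothMove m1 m2 a (a + m1) P refl IH bnd sp rN odr) ((combR (isOdd a) m1 m2 (trans (sym (isOdd-+ a m1)) odr)))
  comb-optR-≰ m a P IH bnd sp y my | rrowLeft () _ _ _
  comb-optR-≰ m a P IH bnd sp y my | rrowRight () _ _ _

  comb-coversL : ∀ m a P → CombValueBelow m → a + m ≤ suc N → Realises (Segment a (a + m) false false) P → ∀ u → u ∈ optL (combValue (isOdd a) m) → ∃ λ (x : Game) → x ∈ optL (domineering P) × u ≤G x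
  comb-coversL zero a P IH bnd sp u ()
  comb-coversL (suc zero) a P IH bnd sp u mu with isOdd a | mu
  ... | false | ()
  ... | true | ()
  comb-coversL (suc (suc m2)) a P IH bnd sp u mu =
    _ , columnMove∈optL a sp ≤-refl (≤-trans (s≤s (s≤s (m≤m+n a m2))) (≤-reflexive (sym (plusS2 a m2)))) ,
    ≤-via-≈ʳ (subst (λ b → domineering (rm2 up (cell 1 a) P) ≈G (combValue (isOdd a) 0 +G combValue b m2)) (xor-identityʳ (isOdd a)) (comb-columnMove 0 m2 a a P (+-identityʳ a) IH bnd sp))
          (lookup (combEL (isOdd a) m2) mu)

  comb-coversR : ∀ m a P → CombValueBelow m → a + m ≤ suc N → Realises (Segment a (a + m) false false) P → ∀ z → z ∈ optR (combValue (isOdd a) m) → ∃ λ (y : Game) → y ∈ optR (domineering P) × y ≤G z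
  comb-coversR m a P IH bnd sp z mz with isOdd a in eq
  comb-coversR zero a P IH bnd sp z () | true
  comb-coversR (suc m2) a P IH bnd sp z mz | true =
    _ , toothMove∈optR a sp ≤-refl (≤-trans (s≤s (m≤m+n a m2)) (≤-reflexive (sym (plusS1 a m2)))) rN eq ,
    ≤-via-≈ˡ (subst (λ b → domineering (rm2 right (cell 1 a) P) ≈G (combValue b 0 +G combValue false m2)) eq (comb-toothMove 0 m2 a a P (+-identityʳ a) IH bnd sp rN eq))
          (lookup (combER₀ m2) mz)
    where
    rN : a < N
    rN = isOdd⇒<N eq (≤-pred (≤-trans (≤-trans (s≤s (m≤m+n a m2)) (≤-reflexive (sym (plusS1 a m2)))) bnd))
  comb-coversR zero a P IH bnd sp z () | false
  comb-coversR (suc zero) a P IH bnd sp z () | false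
  comb-coversR (suc (suc m2)) a P IH bnd sp z mz | false =
    _ , toothMove∈optR (suc a) sp (n≤1+n a) (≤-trans (s≤s (s≤s (m≤m+n a m2))) (≤-reflexive (sym (plusS2 a m2)))) rN o1 ,
    ≤-via-≈ˡ (subst (λ b → domineering (rm2 right (cell 1 (suc a)) P) ≈G (combValue b 1 +G combValue false m2)) eq (comb-toothMove 1 m2 a (suc a) P (trans (+-suc a 0) (cong suc (+-identityʳ a))) IH bnd sp rN o1))
          (lookup (combER₁ m2) mz)
    where
    o1 : isOdd (suc a) ≡ true
    o1 = trans (isOdd-suc a) (cong not eq)
    rN : suc a < N
    rN = isOdd⇒<N o1 (≤-pred (≤-trans (≤-trans (s≤s (s≤s (m≤m+n a m2))) (≤-reflexive (sym (plusS2 a m2)))) bnd))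

  comb-value : ∀ m → CombValue m
  comb-value = <-rec CombValue λ m rec a P bnd sp →
    let IH = λ m′ → rec {m′} in
    ≈G-byOptions (domineering P) (combValue (isOdd a) m)
      (comb-optL-≱ m a P IH bnd sp) (comb-optR-≰ m a P IH bnd sp) (comb-coversL m a P IH bnd sp) (comb-coversR m a P IH bnd sp)


  isOdd-hook₀ : isOdd hook₀ ≡ false
  isOdd-hook₀ = isOdd-N

  isOdd-stemStart : ∀ a d → a + d ≡ hook₀ → isOdd a ≡ isOdd d
  isOdd-stemStart a d e = xor≡false⇒≡ (isOdd a) (isOdd d) (trans (sym (isOdd-+ a d)) (trans (cong isOdd e) isOdd-hook₀))

  StemValue : ℕ → Set
  StemValue d = ∀ a P → a + d ≡ hook₀ → Realises (Segment a hook₀ false false) P → domineering P ≈G stemValue d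

  StemValueBelow : ℕ → Set
  StemValueBelow d = ∀ d' → d' < d → StemValue d'

  hook₀≤hook₁ : hook₀ ≤ hook₁
  hook₀≤hook₁ = n≤1+n hook₀

  stem-columnMove : ∀ m1 d2 a r P → a + m1 ≡ r → StemValueBelow (suc (suc (m1 + d2))) → a + suc (suc (m1 + d2)) ≡ hook₀
    → Realises (Segment a hook₀ false false) P
    → domineering (rm2 up (cell 1 r) P) ≈G (combValue (isOdd a) m1 +G stemValue d2)
  stem-columnMove m1 d2 a .(a + m1) P refl IH e sp =
    let (L , U , spL , spU , eqv) = ColumnMove.split a hook₀ false false hook₀≤hook₁ (a + m1) (m≤m+n a m1) (≤-trans (s≤s (s≤s (m≤m+n (a + m1) d2))) (≤-reflexive (trans (sym (plus2 a m1 d2)) e))) P sp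
    in
    ≈G-trans eqv (+G-cong (comb-value m1 a L bndL spL) (IH d2 (m2<2 m1 d2) (suc (suc (a + m1))) U (trans (sym (plus2 a m1 d2)) e) spU))
    where
    bndL : a + m1 ≤ suc N
    bndL = ≤-pred (≤-trans (s≤s (≤-trans (m≤m+n (a + m1) d2) (n≤1+n _))) (≤-reflexive (trans (sym (plus2 a m1 d2)) e)))

  stem-toothMove : ∀ m1 d2 a r P → a + m1 ≡ r → StemValueBelow (suc (m1 + d2)) → a + suc (m1 + d2) ≡ hook₀
    → Realises (Segment a hook₀ false false) P → r < N → isOdd r ≡ true
    → domineering (rm2 right (cell 1 r) P) ≈G (combValue (isOdd a) m1 +G stemValue d2)
  stem-toothMove m1 d2 a .(a + m1) P refl IH e sp rN odr =
    let (L , U , spL , spU , eqv) = ToothMove.split a hook₀ false false hook₀≤hook₁ (a + m1) (m≤m+n a m1) (<-trans rN N<hook₀) rN odr P sp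
    in
    ≈G-trans eqv (+G-cong (comb-value m1 a L (≤-trans (<⇒≤ rN) (n≤1+n N)) spL) (IH d2 (m2<1 m1 d2) (suc (a + m1)) U (trans (sym (plus1 a m1 d2)) e) spU))

  stem-toothRest : ∀ a m1 d2 → a + suc (m1 + d2) ≡ hook₀ → a + m1 < N → isOdd (a + m1) ≡ true → ∃ λ (d2' : ℕ) → d2 ≡ suc (suc d2') × isOdd d2' ≡ false
  stem-toothRest a m1 zero e rN o = ⊥-elim (<⇒≱ rN (≤-trans (n≤1+n N) (≤-reflexive (sym e'))))
    where e' : a + m1 ≡ suc N
          e' = cong pred (trans (sym (trans (plus1 a m1 0) (cong suc (+-identityʳ (a + m1))))) e)
  stem-toothRest a m1 (suc zero) e rN o = ⊥-elim (<⇒≱ rN (≤-reflexive (sym e')))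
    where e' : a + m1 ≡ N
          e' = cong pred (cong pred (trans (sym (trans (plus1 a m1 1) (cong suc (trans (+-suc (a + m1) 0) (cong suc (+-identityʳ (a + m1))))))) e))
  stem-toothRest a m1 (suc (suc d2')) e rN o = d2' , refl , par
    where
    par : isOdd d2' ≡ false
    par = begin
      isOdd d2'                                   ≡⟨ sym (not-involutive (isOdd d2')) ⟩
      not (true xor isOdd d2')                       ≡⟨ cong (λ b → not (b xor isOdd d2')) (sym o) ⟩
      not (isOdd (a + m1) xor isOdd d2')             ≡⟨ cong not (sym (isOdd-+ (a + m1) (suc (suc d2')))) ⟩
      not (isOdd (a + m1 + suc (suc d2')))        ≡⟨ sym (isOdd-suc (a + m1 + suc (suc d2'))) ⟩
      isOdd (suc (a + m1 + suc (suc d2')))        ≡⟨ cong isOdd (sym (plus1 a m1 (suc (suc d2')))) ⟩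
      isOdd (a + suc (m1 + suc (suc d2')))        ≡⟨ cong isOdd e ⟩
      isOdd hook₀                                    ≡⟨ isOdd-hook₀ ⟩
      false ∎
      where open ≡-Reasoning

  stem-optL-≱ : ∀ d a P → StemValueBelow d → a + d ≡ hook₀ → Realises (Segment a hook₀ false false) P → ∀ x → x ∈ optL (domineering P) → ¬ (stemValue d ≤G x)
  stem-optL-≱ d a P IH e sp x mx with leftMove-cases hook₀≤hook₁ sp mx
  ... | lcolumn r ar re refl with split-columnMove {a} {d} ar (subst (suc (suc r) ≤_) (sym e) re)
  ...   | m1 , m2 , refl , refl =
    ≰-via-≈ʳ (subst (λ b → domineering (rm2 up (cell 1 (a + m1)) P) ≈G (combValue b m1 +G stemValue m2)) (isOdd-stemStart a (suc (suc (m1 + m2))) e) (stem-columnMove m1 m2 a (a + m1) P refl IH e sp))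
         (stemL m1 m2)
  stem-optL-≱ d a P IH e sp x mx | lleftHook () _
  stem-optL-≱ d a P IH e sp x mx | lrightHook () _

  stem-optR-≰ : ∀ d a P → StemValueBelow d → a + d ≡ hook₀ → Realises (Segment a hook₀ false false) P → ∀ y → y ∈ optR (domineering P) → ¬ (y ≤G stemValue d)
  stem-optR-≰ d a P IH e sp y my with rightMove-cases hook₀≤hook₁ sp my
  ... | rtooth r ar re rN odr refl with split-toothMove {a} {d} ar (subst (r <_) (sym e) re)
  ...   | m1 , m2 , refl , refl with stem-toothRest a m1 m2 e rN odr
  ...     | d2' , refl , c =
    ≰-via-≈ˡ (subst (λ b → domineering (rm2 right (cell 1 (a + m1)) P) ≈G (combValue b m1 +G stemValue (suc (suc d2')))) (isOdd-stemStart a (suc (m1 + suc (suc d2'))) e) (stem-toothMove m1 (suc (suc d2')) a (a + m1) P refl IH e sp rN odr))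
         (stemR m1 d2' c)
  stem-optR-≰ d a P IH e sp y my | rrowLeft () _ _ _
  stem-optR-≰ d a P IH e sp y my | rrowRight () _ _ _

  stem-coversL : ∀ d a P → StemValueBelow d → a + d ≡ hook₀ → Realises (Segment a hook₀ false false) P → ∀ u → u ∈ optL (stemValue d) → ∃ λ (x : Game) → x ∈ optL (domineering P) × u ≤G x
  stem-coversL zero a P IH e sp u ()
  stem-coversL (suc zero) a P IH e sp u ()
  stem-coversL (suc (suc d2)) a P IH e sp u mu =
    _ , columnMove∈optL a sp ≤-refl (≤-trans (s≤s (s≤s (m≤m+n a d2))) (≤-reflexive (trans (sym (plusS2 a d2)) e))) ,
    ≤-via-≈ʳ (stem-columnMove 0 d2 a a P (+-identityʳ a) IH e sp) (lookup (stemEL d2) mu)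

  stem-coversR : ∀ d a P → StemValueBelow d → a + d ≡ hook₀ → Realises (Segment a hook₀ false false) P → ∀ z → z ∈ optR (stemValue d) → ∃ λ (y : Game) → y ∈ optR (domineering P) × y ≤G z
  stem-coversR zero a P IH e sp z ()
  stem-coversR (suc zero) a P IH e sp z ()
  stem-coversR (suc (suc zero)) a P IH e sp z ()
  stem-coversR (suc (suc (suc d2))) a P IH e sp z mz with isOdd (suc (suc (suc d2))) in eq
  ... | true =
    _ , toothMove∈optR a sp ≤-refl (≤-trans (s≤s (m≤m+n a (suc (suc d2)))) (≤-reflexive (trans (sym (plusS1 a (suc (suc d2)))) e))) rN oa ,
    ≤-via-≈ˡ (stem-toothMove 0 (suc (suc d2)) a a P (+-identityʳ a) IH e sp rN oa) (lookup (stemER₀ d2 c) mz)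
    where
    oa : isOdd a ≡ true
    oa = trans (isOdd-stemStart a (suc (suc (suc d2))) e) eq
    c : isOdd d2 ≡ false
    c = not-injective {y = false} (trans (sym (isOdd-suc d2)) eq)
    rN : a < N
    rN = ≤-pred (≤-pred (≤-trans (≤-trans (s≤s (s≤s (s≤s (m≤m+n a d2)))) (≤-reflexive (sym (trans (+-suc a (suc (suc d2))) (cong suc (plusS2 a d2)))))) (≤-reflexive e)))
  stem-coversR (suc (suc (suc zero))) a P IH e sp z mz | false = ⊥-elim (false≢true (sym eq))
  stem-coversR (suc (suc (suc (suc d2')))) a P IH e sp z mz | false =
    _ , toothMove∈optR (suc a) sp (n≤1+n a) (≤-trans (s≤s (s≤s (m≤m+n a (suc (suc d2'))))) (≤-reflexive (trans (sym (plusS2 a (suc (suc d2')))) e))) rN o1 ,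
    ≤-via-≈ˡ (subst (λ b → domineering (rm2 right (cell 1 (suc a)) P) ≈G (combValue b 1 +G stemValue (suc (suc d2')))) oa
            (stem-toothMove 1 (suc (suc d2')) a (suc a) P (trans (+-suc a 0) (cong suc (+-identityʳ a))) IH e sp rN o1))
          (lookup (stemER₁ d2' eq) mz)
    where
    oa : isOdd a ≡ false
    oa = trans (isOdd-stemStart a (suc (suc (suc (suc d2')))) e) eq
    o1 : isOdd (suc a) ≡ true
    o1 = trans (isOdd-suc a) (cong not oa)
    rN : suc a < N
    rN = ≤-pred (≤-pred (≤-trans (≤-trans (s≤s (s≤s (s≤s (s≤s (m≤m+n a d2'))))) (≤-reflexive (sym (trans (plusS2 a (suc (suc d2'))) (cong (λ z → suc (suc z)) (plusS2 a d2')))))) (≤-reflexive e)))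

  stem-value : ∀ d → StemValue d
  stem-value = <-rec StemValue λ d rec a P e sp →
    let IH = λ d′ → rec {d′} in
    ≈G-byOptions (domineering P) (stemValue d) (stem-optL-≱ d a P IH e sp) (stem-optR-≰ d a P IH e sp) (stem-coversL d a P IH e sp) (stem-coversR d a P IH e sp)


  isOdd-hook₁ : isOdd hook₁ ≡ true
  isOdd-hook₁ = trans (isOdd-suc hook₀) (cong not isOdd-hook₀)

  isOdd-hookedStart : ∀ a d → a + d ≡ hook₁ → isOdd a ≡ not (isOdd d)
  isOdd-hookedStart a d e = xor≡true⇒≡not (isOdd a) (isOdd d) (trans (sym (isOdd-+ a d)) (trans (cong isOdd e) isOdd-hook₁))

  HookedValue : Bool → Bool → ℕ → Set
  HookedValue hl hr d = ∀ a P → a + d ≡ hook₁ → Realises (Segment a hook₁ hl hr) P → domineering P ≈G hookValue hl hr d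

  HookedValues : Bool → Bool → Set
  HookedValues hl hr = ∀ d → HookedValue hl hr d

  HookedValueBelow : Bool → Bool → ℕ → Set
  HookedValueBelow hl hr d = ∀ d' → d' < d → HookedValue hl hr d'

  hooked-columnMove : ∀ hl hr m1 d2 a r P → a + m1 ≡ r → HookedValueBelow hl hr (suc (suc (m1 + d2))) → a + suc (suc (m1 + d2)) ≡ hook₁
    → Realises (Segment a hook₁ hl hr) P
    → domineering (rm2 up (cell 1 r) P) ≈G (combValue (isOdd a) m1 +G hookValue hl hr d2)
  hooked-columnMove hl hr m1 d2 a .(a + m1) P refl IH e sp =
    let (L , U , spL , spU , eqv) = ColumnMove.split a hook₁ hl hr ≤-refl (a + m1) (m≤m+n a m1) (≤-trans (s≤s (s≤s (m≤m+n (a + m1) d2))) (≤-reflexive (trans (sym (plus2 a m1 d2)) e))) P sp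
    in
    ≈G-trans eqv (+G-cong (comb-value m1 a L bndL spL) (IH d2 (m2<2 m1 d2) (suc (suc (a + m1))) U (trans (sym (plus2 a m1 d2)) e) spU))
    where
    bndL : a + m1 ≤ suc N
    bndL = ≤-pred (≤-pred (≤-trans (s≤s (s≤s (m≤m+n (a + m1) d2))) (≤-reflexive (trans (sym (plus2 a m1 d2)) e))))

  hooked-toothMove : ∀ hl hr m1 d2 a r P → a + m1 ≡ r → HookedValueBelow hl hr (suc (m1 + d2)) → a + suc (m1 + d2) ≡ hook₁
    → Realises (Segment a hook₁ hl hr) P → r < N → isOdd r ≡ true
    → domineering (rm2 right (cell 1 r) P) ≈G (combValue (isOdd a) m1 +G hookValue hl hr d2)
  hooked-toothMove hl hr m1 d2 a .(a + m1) P refl IH e sp rN odr =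
    let (L , U , spL , spU , eqv) = ToothMove.split a hook₁ hl hr ≤-refl (a + m1) (m≤m+n a m1) (<-trans rN (<-trans N<hook₀ (n<1+n hook₀))) rN odr P sp
    in
    ≈G-trans eqv (+G-cong (comb-value m1 a L (≤-trans (<⇒≤ rN) (n≤1+n N)) spL) (IH d2 (m2<1 m1 d2) (suc (a + m1)) U (trans (sym (plus1 a m1 d2)) e) spU))

  hooked-leftHookMove : ∀ hl hr d a P → hl ≡ true → HookedValues false hr → a + d ≡ hook₁ → Realises (Segment a hook₁ hl hr) P
    → domineering (rm2 up (cell 0 hook₀) P) ≈G hookValue false hr d
  hooked-leftHookMove hl hr d a P h T e sp = T d a _ e (LeftHookMove.split a hook₁ hl hr h P sp)

  hooked-rightHookMove : ∀ hl hr d a P → hr ≡ true → HookedValues hl false → a + d ≡ hook₁ → Realises (Segment a hook₁ hl hr) P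
    → domineering (rm2 up (cell 2 hook₀) P) ≈G hookValue hl false d
  hooked-rightHookMove hl hr d a P h T e sp = T d a _ e (RightHookMove.split a hook₁ hl hr h P sp)

  hooked-rowMoveLeft : ∀ hl hr d' a P → hl ≡ true → HookedValues false hr → a + suc d' ≡ hook₁ → Realises (Segment a hook₁ hl hr) P
    → domineering (rm2 right (cell 0 hook₀) P) ≈G (stemValue d' +G hookValue false hr 0)
  hooked-rowMoveLeft hl hr d' a P h T e sp =
    let (L , U , spL , spU , eqv) = RowMoveLeft.split a hook₁ hl hr ≤-refl h ≤hook₀ (n<1+n hook₀) P sp
    in ≈G-trans eqv (+G-cong (stem-value d' a L e' spL) (T 0 hook₁ U (+-identityʳ hook₁) spU))
    where
    ≤hook₀ : a ≤ hook₀
    ≤hook₀ = ≤-pred (≤-trans (s≤s (m≤m+n a d')) (≤-reflexive (trans (sym (plusS1 a d')) e)))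
    e' : a + d' ≡ hook₀
    e' = cong pred (trans (sym (plusS1 a d')) e)

  hooked-rowMoveRight : ∀ hl hr d' a P → hr ≡ true → HookedValues hl false → a + suc d' ≡ hook₁ → Realises (Segment a hook₁ hl hr) P
    → domineering (rm2 right (cell 1 hook₀) P) ≈G (stemValue d' +G hookValue hl false 0)
  hooked-rowMoveRight hl hr d' a P h T e sp =
    let (L , U , spL , spU , eqv) = RowMoveRight.split a hook₁ hl hr ≤-refl h ≤hook₀ (n<1+n hook₀) P sp
    in ≈G-trans eqv (+G-cong (stem-value d' a L e' spL) (T 0 hook₁ U (+-identityʳ hook₁) spU))
    where
    ≤hook₀ : a ≤ hook₀
    ≤hook₀ = ≤-pred (≤-trans (s≤s (m≤m+n a d')) (≤-reflexive (trans (sym (plusS1 a d')) e)))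
    e' : a + d' ≡ hook₀
    e' = cong pred (trans (sym (plusS1 a d')) e)

  ≤hook₀ : ∀ a d' → a + suc d' ≡ hook₁ → a ≤ hook₀
  ≤hook₀ a d' e = ≤-pred (≤-trans (s≤s (m≤m+n a d')) (≤-reflexive (trans (sym (plusS1 a d')) e)))

  +≡hook₀ : ∀ a m1 d2 → a + suc (m1 + d2) ≡ hook₁ → a + m1 + d2 ≡ hook₀
  +≡hook₀ a m1 d2 e = cong pred (trans (sym (plus1 a m1 d2)) e)

  hooked-toothRest : ∀ a m1 d2 → a + suc (m1 + d2) ≡ hook₁ → a + m1 < N → isOdd (a + m1) ≡ true → ∃ λ (d2' : ℕ) → d2 ≡ suc (suc (suc d2')) × isOdd d2' ≡ false
  hooked-toothRest a m1 zero e rN o = ⊥-elim (<⇒≱ rN (≤-trans (<⇒≤ N<hook₀) (≤-reflexive (sym (trans (sym (+-identityʳ (a + m1))) (+≡hook₀ a m1 0 e))))))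
  hooked-toothRest a m1 (suc zero) e rN o = ⊥-elim (<⇒≱ rN (≤-trans (n≤1+n N) (≤-reflexive (sym (cong pred (trans (sym (trans (+-suc (a + m1) 0) (cong suc (+-identityʳ (a + m1))))) (+≡hook₀ a m1 1 e)))))))
  hooked-toothRest a m1 (suc (suc zero)) e rN o = ⊥-elim (<⇒≱ rN (≤-reflexive (sym (cong pred (cong pred (trans (sym (trans (plusS2 (a + m1) 0) (cong (λ z → suc (suc z)) (+-identityʳ (a + m1))))) (+≡hook₀ a m1 2 e)))))))
  hooked-toothRest a m1 (suc (suc (suc d2'))) e rN o = d2' , refl , par
    where
    par : isOdd d2' ≡ false
    par = begin
      isOdd d2'                                          ≡⟨ sym (not-involutive (isOdd d2')) ⟩
      not (not (isOdd d2'))                              ≡⟨ cong (λ b → b xor not (isOdd d2')) (sym o) ⟩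
      isOdd (a + m1) xor not (isOdd d2')                     ≡⟨ cong (isOdd (a + m1) xor_) (sym (isOdd-suc d2')) ⟩
      isOdd (a + m1) xor isOdd (suc (suc (suc d2')))         ≡⟨ sym (isOdd-+ (a + m1) (suc (suc (suc d2')))) ⟩
      isOdd (a + m1 + suc (suc (suc d2')))               ≡⟨ cong isOdd (+≡hook₀ a m1 (suc (suc (suc d2'))) e) ⟩
      isOdd hook₀                                           ≡⟨ isOdd-hook₀ ⟩
      false ∎
      where open ≡-Reasoning

  ≢hook₁ : ∀ {a} → a ≤ hook₀ → a + 0 ≡ hook₁ → ⊥
  ≢hook₁ {a} p e = <⇒≱ (s≤s p) (≤-reflexive (sym (trans (sym (+-identityʳ a)) e)))

  hooked-optL-≱ : ∀ hl hr d a P → HookedValueBelow hl hr d → (hl ≡ true → HookedValues false hr) → (hr ≡ true → HookedValues hl false) → a + d ≡ hook₁ → Realises (Segment a hook₁ hl hr) P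
    → ∀ x → x ∈ optL (domineering P) → ¬ (hookValue hl hr d ≤G x)
  hooked-optL-≱ hl hr d a P IH TL TR e sp x mx with leftMove-cases ≤-refl sp mx
  ... | lcolumn r ar re refl with split-columnMove {a} {d} ar (subst (suc (suc r) ≤_) (sym e) re)
  ...   | m1 , m2 , refl , refl =
    ≰-via-≈ʳ (subst (λ b → domineering (rm2 up (cell 1 (a + m1)) P) ≈G (combValue b m1 +G hookValue hl hr m2)) (isOdd-hookedStart a (suc (suc (m1 + m2))) e) (hooked-columnMove hl hr m1 m2 a (a + m1) P refl IH e sp))
         (hookedL hl hr m1 m2)
  hooked-optL-≱ true hr d a P IH TL TR e sp x mx | lleftHook refl refl = ≰-via-≈ʳ (hooked-leftHookMove true hr d a P refl (TL refl) e sp) (leftHookL hr d)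
  hooked-optL-≱ hl true d a P IH TL TR e sp x mx | lrightHook refl refl = ≰-via-≈ʳ (hooked-rightHookMove hl true d a P refl (TR refl) e sp) (rightHookL hl d)

  hooked-rowMoveLeft-≰ : ∀ hr d a P → HookedValues false hr → a + d ≡ hook₁ → a ≤ hook₀ → Realises (Segment a hook₁ true hr) P → ¬ (domineering (rm2 right (cell 0 hook₀) P) ≤G hookValue true hr d)
  hooked-rowMoveLeft-≰ hr zero a P T e ≤hook₀ sp = ⊥-elim (≢hook₁ ≤hook₀ e)
  hooked-rowMoveLeft-≰ hr (suc d') a P T e ≤hook₀ sp = ≰-via-≈ˡ (hooked-rowMoveLeft true hr d' a P refl T e sp) (rowLeftR hr d')

  hooked-rowMoveRight-≰ : ∀ hl d a P → HookedValues hl false → a + d ≡ hook₁ → a ≤ hook₀ → Realises (Segment a hook₁ hl true) P → ¬ (domineering (rm2 right (cell 1 hook₀) P) ≤G hookValue hl true d)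
  hooked-rowMoveRight-≰ hl zero a P T e ≤hook₀ sp = ⊥-elim (≢hook₁ ≤hook₀ e)
  hooked-rowMoveRight-≰ hl (suc d') a P T e ≤hook₀ sp = ≰-via-≈ˡ (hooked-rowMoveRight hl true d' a P refl T e sp) (rowRightR hl d')

  hooked-optR-≰ : ∀ hl hr d a P → HookedValueBelow hl hr d → (hl ≡ true → HookedValues false hr) → (hr ≡ true → HookedValues hl false) → a + d ≡ hook₁ → Realises (Segment a hook₁ hl hr) P
    → ∀ y → y ∈ optR (domineering P) → ¬ (y ≤G hookValue hl hr d)
  hooked-optR-≰ hl hr d a P IH TL TR e sp y my with rightMove-cases ≤-refl sp my
  ... | rtooth r ar re rN odr refl with split-toothMove {a} {d} ar (subst (r <_) (sym e) re)
  ...   | m1 , m2 , refl , refl with hooked-toothRest a m1 m2 e rN odr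
  ...     | d2' , refl , c =
    ≰-via-≈ˡ (subst (λ b → domineering (rm2 right (cell 1 (a + m1)) P) ≈G (combValue b m1 +G hookValue hl hr (suc (suc (suc d2'))))) (isOdd-hookedStart a (suc (m1 + suc (suc (suc d2')))) e)
            (hooked-toothMove hl hr m1 (suc (suc (suc d2'))) a (a + m1) P refl IH e sp rN odr))
         (hookedR hl hr m1 d2' c)
  hooked-optR-≰ true hr d a P IH TL TR e sp y my | rrowLeft refl ≤hook₀ He refl = hooked-rowMoveLeft-≰ hr d a P (TL refl) e ≤hook₀ sp
  hooked-optR-≰ hl true d a P IH TL TR e sp y my | rrowRight refl ≤hook₀ He refl = hooked-rowMoveRight-≰ hl d a P (TR refl) e ≤hook₀ sp

  2+≤hook₁ : ∀ a d → a + suc (suc d) ≡ hook₁ → suc (suc a) ≤ hook₁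
  2+≤hook₁ a d e = ≤-trans (s≤s (s≤s (m≤m+n a d))) (≤-reflexive (trans (sym (plusS2 a d)) e))

  hooked-coversL : ∀ hl hr d a P → HookedValueBelow hl hr d → (hl ≡ true → HookedValues false hr) → (hr ≡ true → HookedValues hl false) → a + d ≡ hook₁ → Realises (Segment a hook₁ hl hr) P
    → ∀ u → u ∈ optL (hookValue hl hr d) → ∃ λ (x : Game) → x ∈ optL (domineering P) × u ≤G x
  hooked-coversL false false zero a P IH TL TR e sp u ()
  hooked-coversL false false (suc zero) a P IH TL TR e sp u ()
  hooked-coversL false false (suc (suc d2)) a P IH TL TR e sp u mu =
    _ , columnMove∈optL a sp ≤-refl (2+≤hook₁ a d2 e) , ≤-via-≈ʳ (hooked-columnMove false false 0 d2 a a P (+-identityʳ a) IH e sp) (lookup (noHookEL d2) mu)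
  hooked-coversL true false d a P IH TL TR e sp u mu =
    _ , leftHookMove∈optL sp refl , ≤-via-≈ʳ (hooked-leftHookMove true false d a P refl (TL refl) e sp) (lookup (leftHookEL d) mu)
  hooked-coversL false true d a P IH TL TR e sp u mu =
    _ , rightHookMove∈optL sp refl , ≤-via-≈ʳ (hooked-rightHookMove false true d a P refl (TR refl) e sp) (lookup (rightHookEL d) mu)
  hooked-coversL true true zero a P IH TL TR e sp u mu =
    _ , leftHookMove∈optL sp refl , ≤-via-≈ʳ (hooked-leftHookMove true true 0 a P refl (TL refl) e sp) (lookup (toWitness {a? = all≤? {optL (hookValue true true 0)} {hookValue false true 0}} tt) mu)
  hooked-coversL true true (suc zero) a P IH TL TR e sp u ()
  hooked-coversL true true (suc (suc d)) a P IH TL TR e sp u mu =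
    _ , columnMove∈optL (a + d) sp (m≤m+n a d) (≤-trans (≤-reflexive (sym (plusS2 a d))) (≤-reflexive e)) ,
    ≤-via-≈ʳ (subst (λ b → domineering (rm2 up (cell 1 (a + d)) P) ≈G (combValue b d +G hookValue true true 0)) (isOdd-hookedStart a (suc (suc d)) e) h)
          (lookup (twoHooksEL d) mu)
    where
    d0 : d + 0 ≡ d
    d0 = +-identityʳ d
    h : domineering (rm2 up (cell 1 (a + d)) P) ≈G (combValue (isOdd a) d +G hookValue true true 0)
    h = hooked-columnMove true true d 0 a (a + d) P refl (subst (λ z → HookedValueBelow true true (suc (suc z))) (sym d0) IH) (subst (λ z → a + suc (suc z) ≡ hook₁) (sym d0) e) sp

  hooked-coversR : ∀ hl hr d a P → HookedValueBelow hl hr d → (hl ≡ true → HookedValues false hr) → (hr ≡ true → HookedValues hl false) → a + d ≡ hook₁ → Realises (Segment a hook₁ hl hr) P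
    → ∀ z → z ∈ optR (hookValue hl hr d) → ∃ λ (y : Game) → y ∈ optR (domineering P) × y ≤G z
  hooked-coversR false false zero a P IH TL TR e sp z ()
  hooked-coversR false false (suc zero) a P IH TL TR e sp z ()
  hooked-coversR false false (suc (suc zero)) a P IH TL TR e sp z ()
  hooked-coversR false false (suc (suc (suc zero))) a P IH TL TR e sp z ()
  hooked-coversR false false (suc (suc (suc (suc d2')))) a P IH TL TR e sp z mz with isOdd d2' in eq
  ... | false =
    _ , toothMove∈optR a sp ≤-refl (≤-trans (s≤s (m≤m+n a (suc (suc (suc d2'))))) (≤-reflexive (trans (sym (plusS1 a (suc (suc (suc d2'))))) e))) rN oa ,
    ≤-via-≈ˡ (hooked-toothMove false false 0 (suc (suc (suc d2'))) a a P (+-identityʳ a) IH e sp rN oa) (lookup (noHookER₀ d2' eq) mz)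
    where
    oa : isOdd a ≡ true
    oa = trans (isOdd-hookedStart a (suc (suc (suc (suc d2')))) e) (cong not eq)
    rN : a < N
    rN = ≤-pred (≤-pred (≤-pred (≤-trans (s≤s (s≤s (s≤s (s≤s (m≤m+n a d2'))))) (≤-reflexive (trans (sym (trans (plusS2 a (suc (suc d2'))) (cong (λ q → suc (suc q)) (plusS2 a d2')))) e)))))
  hooked-coversR false false (suc (suc (suc (suc zero)))) a P IH TL TR e sp z mz | true = ⊥-elim (false≢true eq)
  hooked-coversR false false (suc (suc (suc (suc (suc d2''))))) a P IH TL TR e sp z mz | true =
    _ , toothMove∈optR (suc a) sp (n≤1+n a) (≤-trans (s≤s (s≤s (m≤m+n a (suc (suc (suc d2'')))))) (≤-reflexive (trans (sym (plusS2 a (suc (suc (suc d2''))))) e))) rN o1 ,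
    ≤-via-≈ˡ (subst (λ b → domineering (rm2 right (cell 1 (suc a)) P) ≈G (combValue b 1 +G hookValue false false (suc (suc (suc d2''))))) oa
            (hooked-toothMove false false 1 (suc (suc (suc d2''))) a (suc a) P (trans (+-suc a 0) (cong suc (+-identityʳ a))) IH e sp rN o1))
          (lookup (noHookER₁ d2'' c) mz)
    where
    c : isOdd d2'' ≡ false
    c = not-injective {y = false} (trans (sym (isOdd-suc d2'')) eq)
    oa : isOdd a ≡ false
    oa = trans (isOdd-hookedStart a (suc (suc (suc (suc (suc d2''))))) e) (cong not eq)
    o1 : isOdd (suc a) ≡ true
    o1 = trans (isOdd-suc a) (cong not oa)
    rN : suc a < N
    rN = ≤-pred (≤-pred (≤-pred (≤-trans (s≤s (s≤s (s≤s (s≤s (s≤s (m≤m+n a d2'')))))) (≤-reflexive (trans (sym (trans (plusS2 a (suc (suc (suc d2'')))) (cong (λ q → suc (suc q)) (trans (plusS2 a (suc d2'')) (cong (λ q → suc (suc q)) (plusS1 a d2'')))))) e)))))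
  hooked-coversR true false zero a P IH TL TR e sp z ()
  hooked-coversR true false (suc d') a P IH TL TR e sp z mz =
    _ , rowMoveLeft∈optR sp refl (≤hook₀ a d' e) (n<1+n hook₀) , ≤-via-≈ˡ (hooked-rowMoveLeft true false d' a P refl (TL refl) e sp) (lookup (leftHookER d') mz)
  hooked-coversR false true zero a P IH TL TR e sp z ()
  hooked-coversR false true (suc d') a P IH TL TR e sp z mz =
    _ , rowMoveRight∈optR sp refl (≤hook₀ a d' e) (n<1+n hook₀) , ≤-via-≈ˡ (hooked-rowMoveRight false true d' a P refl (TR refl) e sp) (lookup (rightHookER d') mz)
  hooked-coversR true true zero a P IH TL TR e sp z ()
  hooked-coversR true true (suc d') a P IH TL TR e sp z mz =
    _ , rowMoveLeft∈optR sp refl (≤hook₀ a d' e) (n<1+n hook₀) , ≤-via-≈ˡ (hooked-rowMoveLeft true true d' a P refl (TL refl) e sp) (lookup (twoHooksER d') mz)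

  hooked-value : ∀ hl hr → (hl ≡ true → HookedValues false hr) → (hr ≡ true → HookedValues hl false) → HookedValues hl hr
  hooked-value hl hr TL TR = <-rec (HookedValue hl hr) λ d rec a P e sp →
    let IH = λ d′ → rec {d′} in
    ≈G-byOptions (domineering P) (hookValue hl hr d)
      (hooked-optL-≱ hl hr d a P IH TL TR e sp) (hooked-optR-≰ hl hr d a P IH TL TR e sp) (hooked-coversL hl hr d a P IH TL TR e sp) (hooked-coversR hl hr d a P IH TL TR e sp)

  noHook-value : HookedValues false false
  noHook-value = hooked-value false false (λ ()) (λ ())
  leftHook-value : HookedValues true false
  leftHook-value = hooked-value true false (λ _ → noHook-value) (λ ())
  rightHook-value : HookedValues false true
  rightHook-value = hooked-value false true (λ ()) (λ _ → noHook-value)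
  twoHooks-value : HookedValues true true
  twoHooks-value = hooked-value true true (λ _ → rightHook-value) (λ _ → leftHook-value)




-- The value of L_n^∪

module Lcup-shape (n : ℕ) where
  open Geometry (2 * n)

  column₁ teeth hooks : List Cell
  column₁ = map (λ y → cell 1 y) (upTo (2 * n + 3))
  teeth = map (λ i → cell 2 (2 * i + 1)) (upTo n)
  hooks = cell 0 (2 * n + 2) ∷ cell 2 (2 * n + 2) ∷ cell 0 (2 * n + 3) ∷ cell 2 (2 * n + 3) ∷ []

  hook₀≡ : 2 * n + 2 ≡ hook₀
  hook₀≡ = +-comm (2 * n) 2

  hook₁≡ : 2 * n + 3 ≡ hook₁
  hook₁≡ = +-comm (2 * n) 3

  tooth-row< : ∀ {i} → i < n → 2 * i + 1 < 2 * n
  tooth-row< {i} p = ≤-trans (≤-reflexive (trans (cong suc (+-comm (2 * i) 1)) (sym (*-suc 2 i)))) (*-monoʳ-≤ 2 p)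

  tooth-row<⁻ : ∀ {i} → 2 * i + 1 < 2 * n → i < n
  tooth-row<⁻ {i} p = *-cancelˡ-< 2 i n (≤-<-trans (m≤m+n (2 * i) 1) p)

  isOdd-tooth-row : ∀ i → isOdd (2 * i + 1) ≡ true
  isOdd-tooth-row i = trans (cong isOdd (+-comm (2 * i) 1)) (trans (isOdd-suc (2 * i)) (cong not (isOdd-double i)))

  to : ∀ c → c ∈ Lcup n → ∃₂ λ x y → c ≡ cell x y × Segment 0 hook₁ true true x y
  to c m with ∈-++⁻ column₁ m
  ... | inj₁ p = let (y , py , e) = ∈-map⁻ (cell 1) p in 1 , y , e , z≤n , subst (y <_) hook₁≡ (∈-upTo⁻ py)
  ... | inj₂ p with ∈-++⁻ teeth p
  ...   | inj₁ q = let (i , pi , e) = ∈-map⁻ (λ i → cell 2 (2 * i + 1)) q ; i<n = tooth-row< (∈-upTo⁻ pi) in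
                   2 , 2 * i + 1 , e , inj₁ (z≤n , <-trans i<n (s≤s (≤-trans (n≤1+n _) (n≤1+n _))) , i<n , isOdd-tooth-row i)
  ...   | inj₂ (here refl) = 0 , 2 * n + 2 , refl , refl , inj₁ hook₀≡
  ...   | inj₂ (there (here refl)) = 2 , 2 * n + 2 , refl , inj₂ (refl , inj₁ hook₀≡)
  ...   | inj₂ (there (there (here refl))) = 0 , 2 * n + 3 , refl , refl , inj₂ hook₁≡
  ...   | inj₂ (there (there (there (here refl)))) = 2 , 2 * n + 3 , refl , inj₂ (refl , inj₂ hook₁≡)

  hook∈ : ∀ {x y} → cell x y ∈ hooks → cell x y ∈ Lcup n
  hook∈ m = ∈-++⁺ʳ column₁ (∈-++⁺ʳ teeth m)

  from : ∀ x y → Segment 0 hook₁ true true x y → cell x y ∈ Lcup n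
  from 0 y (_ , inj₁ refl) = hook∈ (subst (λ z → cell 0 z ∈ hooks) hook₀≡ (here refl))
  from 0 y (_ , inj₂ refl) = hook∈ (subst (λ z → cell 0 z ∈ hooks) hook₁≡ (there (there (here refl))))
  from 1 y (_ , p) = ∈-++⁺ˡ (∈-map⁺ (cell 1) (∈-upTo⁺ (subst (y <_) (sym hook₁≡) p)))
  from 2 y (inj₁ (_ , _ , t , o)) with isOdd⇒odd y o
  ... | i , refl = ∈-++⁺ʳ column₁ (∈-++⁺ˡ (∈-map⁺ (λ i → cell 2 (2 * i + 1)) {x = i} (∈-upTo⁺ (tooth-row<⁻ t))))
  from 2 y (inj₂ (_ , inj₁ refl)) = hook∈ (subst (λ z → cell 2 z ∈ hooks) hook₀≡ (there (here refl)))
  from 2 y (inj₂ (_ , inj₂ refl)) = hook∈ (subst (λ z → cell 2 z ∈ hooks) hook₁≡ (there (there (there (here refl)))))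

  realises : Realises (Segment 0 hook₁ true true) (Lcup n)
  realises = to , from

Lcup-value : ∀ n → domineering (Lcup n) ≈G hookValue true true (3 + 2 * n)
Lcup-value n = Values.twoHooks-value (2 * n) (isOdd-double n) _ 0 (Lcup n) refl (Lcup-shape.realises n)

twoHooks-even : ∀ k → hookValue true true (3 + k * 4) ≡ twoStar
twoHooks-even 0 = refl
twoHooks-even 1 = refl
twoHooks-even (suc (suc k)) = twoHooks-even (suc k)

twoHooks-odd : ∀ k → hookValue true true (5 + k * 4) ≡ twoG
twoHooks-odd 0 = refl
twoHooks-odd (suc k) = twoHooks-odd k

twoStar≈2* : twoStar ≈G twoStarG
twoStar≈2* = toWitness {a? = twoStar ≤G? twoStarG} tt , toWitness {a? = twoStarG ≤G? twoStar} tt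

Lcup-value-even : ∀ k → domineering (Lcup (k * 2)) ≈G twoStarG
Lcup-value-even k = ≈G-trans (subst (domineering (Lcup (k * 2)) ≈G_) value (Lcup-value (k * 2))) twoStar≈2*
  where
  value : hookValue true true (3 + 2 * (k * 2)) ≡ twoStar
  value = trans (cong (hookValue true true) (solve 1 (λ k → con 3 :+ con 2 :* (k :* con 2) := con 3 :+ k :* con 4) refl k))
                (twoHooks-even k)

Lcup-value-odd : ∀ k → domineering (Lcup (1 + 2 * k)) ≈G twoG
Lcup-value-odd k = subst (domineering (Lcup (1 + 2 * k)) ≈G_) value (Lcup-value (1 + 2 * k))
  where
  value : hookValue true true (3 + 2 * (1 + 2 * k)) ≡ twoG
  value = trans (cong (hookValue true true) (solve 1 (λ k → con 3 :+ con 2 :* (con 1 :+ con 2 :* k) := con 5 :+ k :* con 4) refl k))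
                (twoHooks-odd k)

even⊎odd : ∀ n → (∃ λ k → n ≡ k * 2) ⊎ (∃ λ k → n ≡ 1 + 2 * k)
even⊎odd zero = inj₁ (0 , refl)
even⊎odd (suc n) with even⊎odd n
... | inj₁ (k , refl) = inj₂ (k , cong suc (*-comm k 2))
... | inj₂ (k , refl) = inj₁ (suc k , solve 1 (λ k → con 2 :+ con 2 :* k := (con 1 :+ k) :* con 2) refl k)

lemma2 : (n : ℕ) → 1 ≤ n →
    (2 ∣ n → domineering (Lcup n) ≈G twoStarG) × (¬ (2 ∣ n) → domineering (Lcup n) ≈G twoG)
lemma2 n _ = even , odd
  where
  even : 2 ∣ n → domineering (Lcup n) ≈G twoStarG
  even (divides k refl) = Lcup-value-even k
  odd : ¬ (2 ∣ n) → domineering (Lcup n) ≈G twoG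
  odd 2∤n with even⊎odd n
  ... | inj₁ (k , n≡2k) = ⊥-elim (2∤n (divides k n≡2k))
  ... | inj₂ (k , refl) = Lcup-value-odd k
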